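{- Let $k\ge 3$. Let $G$ be a graph on $n$ vertices whose $k$-configuration graph $\mathcal{R}_k(G)$ contains $r$ connected components $\mathcal{C}_1,\ldots,\mathcal{C}_r$ of diameters respectively $d_1,\ldots,d_r$. Then there exists a graph on at most $n+(3k-2)(r-1)$ vertices whose $k$-configuration graph has diameter at least $(4k-4)(r-1)+\sum_{i\le r} d_i$.
   Context: All graphs are finite, simple and undirected. For a graph $G$ and an integer $k\geq 1$, the $k$-configuration graph $\mathcal{R}_k(G)$ (token jumping model) is the graph whose vertices are the independent sets of $G$ of size exactly $k$, where two such independent sets $I,J$ are adjacent if and only if $|I\cap J|=k-1$. Convention: the diameter of a (possibly disconnected) configuration graph means the largest diameter of one of its connected components. -}

module Defs where

open import Data.Nat using (ℕ; zero; suc; _+_; _*_; _∸_; _≤_; _<_)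
open import Data.Bool using (Bool; true; false)
open import Data.Fin using (Fin)
open import Data.Fin.Subset using (Subset; _∈_; _∩_; ∣_∣)
open import Data.Vec using (tabulate; sum)
open import Data.Product using (Σ; ∃; _×_; _,_)
open import Relation.Binary.PropositionalEquality using (_≡_)
open import Relation.Nullary using (¬_)
open import Function.Bundles using (_⇔_)

record Graph (n : ℕ) : Set where
  field
    Adj    : Fin n → Fin n → Bool
    sym    : ∀ u v → Adj u v ≡ Adj v u
    irrefl : ∀ v → Adj v v ≡ false
open Graph public

module _ {n : ℕ} (G : Graph n) (k : ℕ) where

  Independent : Subset n → Set
  Independent S = ∀ u v → u ∈ S → v ∈ S → Adj G u v ≡ false

  IsKIS : Subset n → Set
  IsKIS S = Independent S × ∣ S ∣ ≡ k

  -- adjacency in R_k(G) (token jumping): |I ∩ J| = k - 1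
  ConfAdj : Subset n → Subset n → Set
  ConfAdj I J = IsKIS I × IsKIS J × ∣ I ∩ J ∣ ≡ k ∸ 1

  data Walk : ℕ → Subset n → Subset n → Set where
    nil  : ∀ {I} → IsKIS I → Walk 0 I I
    cons : ∀ {ℓ I J K} → ConfAdj I J → Walk ℓ J K → Walk (suc ℓ) I K

  Connected : Subset n → Subset n → Set
  Connected I J = ∃ λ ℓ → Walk ℓ I J

  Dist : Subset n → Subset n → ℕ → Set
  Dist I J d = Walk d I J × (∀ m → m < d → ¬ Walk m I J)

  record Components (r : ℕ) (d : Fin r → ℕ) : Set where
    field
      comp     : (S : Subset n) → IsKIS S → Fin r
      surj     : ∀ i → Σ (Subset n) λ S → Σ (IsKIS S) λ p → comp S p ≡ i
      sameComp : ∀ S T (p : IsKIS S) (q : IsKIS T) →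
                 (comp S p ≡ comp T q) ⇔ Connected S T
      diamAttained : ∀ i → Σ (Subset n) λ S → Σ (Subset n) λ T →
                 Σ (IsKIS S) λ p → Σ (IsKIS T) λ q →
                 comp S p ≡ i × comp T q ≡ i × Dist S T (d i)
      diamBound : ∀ i S T (p : IsKIS S) (q : IsKIS T) →
                 comp S p ≡ i → comp T q ≡ i →
                 Σ ℕ λ m → m ≤ d i × Walk m S T

  -- the diameter of R_k(G) (largest diameter of a component) is at least D
  DiameterAtLeast : ℕ → Set
  DiameterAtLeast D = Σ (Subset n) λ I → Σ (Subset n) λ J →
    Connected I J × (∀ m → m < D → ¬ Walk m I J)

sumFin : ∀ {r} → (Fin r → ℕ) → ℕ
sumFin d = sum (tabulate d)

{-# OPTIONS --safe #-}
-- For consecutive components i and i + 1 pick T i and S (i + 1), where S i, T i realise the diameter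
-- d i of component i, and join T i to S (i + 1) by a gadget of M = 3k − 2 new vertices.  Its only new
-- k-independent sets are the interior windows of a path T i = W 0, W 1, …, W (M + k) = S (i + 1) in
-- which consecutive windows share k − 1 vertices while windows further apart share fewer (T i and
-- S (i + 1) lie in different components).  So a walk from S 0 can only enter the windows next to T i
-- and leave them next to S (i + 1): it spends at least M + k − 2 = 4k − 4 steps in each gadget, and
-- at least d i steps inside component i.
module Submission where

open import Defs hiding (sym)
open import Data.Nat using (ℕ; zero; suc; _+_; _*_; _∸_; _≤_; _<_; _⊓_; z≤n; s≤s; s≤s⁻¹; _≤?_; _≟_)
open import Data.Nat.Properties
open import Data.Nat.Solver using (module +-*-Solver)
open import Data.Bool using (Bool; true; false; _∧_; _∨_; not)
open import Data.Bool.Properties using (∨-comm; ∨-conicalˡ; not-injective)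
open import Data.Fin using (Fin; zero; suc; toℕ; fromℕ; inject₁; _↑ˡ_; _↑ʳ_; splitAt)
open import Data.Fin.Properties using (toℕ<n; toℕ-fromℕ; toℕ-inject₁; splitAt-↑ˡ; splitAt-↑ʳ)
open import Data.Fin.Induction using (<-weakInduction)
open import Data.Fin.Subset using (Subset; _∈_; _⊆_; _∩_; _∪_; ∣_∣; ⊥)
open import Data.Fin.Subset.Properties
  using ( p⊆q⇒∣p∣≤∣q∣; drop-∷-⊆; out⊆; s⊆s; ⊥⊆; ∉⊥; ∣⊥∣≡0; ∩-comm; ∩-zeroˡ
        ; p∩q⊆p; p∩q⊆q; ∣p∩q∣≤∣p∣; ∣p∩q∣≤∣q∣; x∈p∩q⁻; x∈p∩q⁺; x∈p∪q⁻; x∈p∪q⁺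
        ; ∪-identityˡ; ∪-identityʳ; nonempty?; Empty-unique)
open import Data.Vec using ([]; _∷_; _++_; here; there; lookup)
import Data.Vec as Vec
open import Data.Vec.Properties
  using (zipWith-++; ++-injectiveˡ; ++-injectiveʳ; []=⇒lookup; lookup⇒[]=; lookup-++ˡ; lookup-++ʳ)
open import Data.Product using (Σ; _×_; _,_; proj₁; proj₂; map)
open import Data.Sum using (_⊎_; inj₁; inj₂)
open import Function using (_∘_)
open import Function.Bundles using (Equivalence)
open import Relation.Nullary using (¬_; Dec; yes; no; does; contradiction)
open import Relation.Nullary.Decidable using (dec-true; dec-false)
open import Relation.Binary.PropositionalEquality
  using (_≡_; refl; sym; trans; cong; cong₂; subst; subst₂; module ≡-Reasoning)

∣p++q∣≡∣p∣+∣q∣ : ∀ {a b} (p : Subset a) (q : Subset b) → ∣ p ++ q ∣ ≡ ∣ p ∣ + ∣ q ∣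
∣p++q∣≡∣p∣+∣q∣ []          q = refl
∣p++q∣≡∣p∣+∣q∣ (true ∷ p)  q = cong suc (∣p++q∣≡∣p∣+∣q∣ p q)
∣p++q∣≡∣p∣+∣q∣ (false ∷ p) q = ∣p++q∣≡∣p∣+∣q∣ p q

++-∩-++ : ∀ {a b} (p r : Subset a) (q s : Subset b) → (p ++ q) ∩ (r ++ s) ≡ (p ∩ r) ++ (q ∩ s)
++-∩-++ p r q s = zipWith-++ _∧_ p q r s

∣p∩q∣≡∣q∩p∣ : ∀ {n} (p q : Subset n) → ∣ p ∩ q ∣ ≡ ∣ q ∩ p ∣
∣p∩q∣≡∣q∩p∣ p q = cong ∣_∣ (∩-comm p q)

p⊆q∧∣q∣≤∣p∣⇒p≡q : ∀ {n} {p q : Subset n} → p ⊆ q → ∣ q ∣ ≤ ∣ p ∣ → p ≡ q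
p⊆q∧∣q∣≤∣p∣⇒p≡q {p = []}        {[]}        p⊆q _         = refl
p⊆q∧∣q∣≤∣p∣⇒p≡q {p = true ∷ p}  {true ∷ q}  p⊆q (s≤s ≤∣p∣) =
  cong (true ∷_) (p⊆q∧∣q∣≤∣p∣⇒p≡q (drop-∷-⊆ p⊆q) ≤∣p∣)
p⊆q∧∣q∣≤∣p∣⇒p≡q {p = true ∷ p}  {false ∷ q} p⊆q _         with () ← p⊆q here
p⊆q∧∣q∣≤∣p∣⇒p≡q {p = false ∷ p} {true ∷ q}  p⊆q ≤∣p∣       =
  contradiction (p⊆q⇒∣p∣≤∣q∣ (drop-∷-⊆ p⊆q)) (<⇒≱ ≤∣p∣)
p⊆q∧∣q∣≤∣p∣⇒p≡q {p = false ∷ p} {false ∷ q} p⊆q ≤∣p∣       =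
  cong (false ∷_) (p⊆q∧∣q∣≤∣p∣⇒p≡q (drop-∷-⊆ p⊆q) ≤∣p∣)

∣p∣≡0⇒p≡⊥ : ∀ {n} {p : Subset n} → ∣ p ∣ ≡ 0 → p ≡ ⊥
∣p∣≡0⇒p≡⊥ ∣p∣≡0 = sym (p⊆q∧∣q∣≤∣p∣⇒p≡q ⊥⊆ (≤-trans (≤-reflexive ∣p∣≡0) z≤n))

x∈p⇒0<∣p∣ : ∀ {n} {x : Fin n} {p : Subset n} → x ∈ p → 0 < ∣ p ∣
x∈p⇒0<∣p∣ {p = true ∷ p}  _               = s≤s z≤n
x∈p⇒0<∣p∣ {p = false ∷ p} (there x∈p) = x∈p⇒0<∣p∣ x∈p

∣∩∣-mono : ∀ {n} {p q r s : Subset n} → p ⊆ r → q ⊆ s → ∣ p ∩ q ∣ ≤ ∣ r ∩ s ∣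
∣∩∣-mono {p = p} {q} p⊆r q⊆s = p⊆q⇒∣p∣≤∣q∣ (x∈p∩q⁺ ∘ map p⊆r q⊆s ∘ x∈p∩q⁻ p q)

∣∩∣-monoʳ : ∀ {n} (p : Subset n) {q r : Subset n} → q ⊆ r → ∣ p ∩ q ∣ ≤ ∣ p ∩ r ∣
∣∩∣-monoʳ p = ∣∩∣-mono {p = p} (λ x∈p → x∈p)

module _ {a b : ℕ} {p : Subset a} {q : Subset b} where

  x∈p⇒x↑ˡ∈p++q : ∀ {x} → x ∈ p → (x ↑ˡ b) ∈ (p ++ q)
  x∈p⇒x↑ˡ∈p++q {x} x∈p = lookup⇒[]= (x ↑ˡ b) (p ++ q) (trans (lookup-++ˡ p q x) ([]=⇒lookup x∈p))

  x↑ˡ∈p++q⇒x∈p : ∀ {x} → (x ↑ˡ b) ∈ (p ++ q) → x ∈ p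
  x↑ˡ∈p++q⇒x∈p {x} x∈ = lookup⇒[]= x p (trans (sym (lookup-++ˡ p q x)) ([]=⇒lookup x∈))

  y∈q⇒a↑ʳy∈p++q : ∀ {y} → y ∈ q → (a ↑ʳ y) ∈ (p ++ q)
  y∈q⇒a↑ʳy∈p++q {y} y∈q = lookup⇒[]= (a ↑ʳ y) (p ++ q) (trans (lookup-++ʳ p q y) ([]=⇒lookup y∈q))

  a↑ʳy∈p++q⇒y∈q : ∀ {y} → (a ↑ʳ y) ∈ (p ++ q) → y ∈ q
  a↑ʳy∈p++q⇒y∈q {y} y∈ = lookup⇒[]= y q (trans (sym (lookup-++ʳ p q y)) ([]=⇒lookup y∈))

data SplitView (a b : ℕ) : Fin (a + b) → Set where
  left  : (x : Fin a) → SplitView a b (x ↑ˡ b)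
  right : (y : Fin b) → SplitView a b (a ↑ʳ y)

splitView : ∀ a b (u : Fin (a + b)) → SplitView a b u
splitView zero    b u       = right u
splitView (suc a) b zero    = left zero
splitView (suc a) b (suc u) with splitView a b u
... | left x  = left (suc x)
... | right y = right y

++-mono-⊆ : ∀ {a b} {p r : Subset a} {q s : Subset b} → p ⊆ r → q ⊆ s → (p ++ q) ⊆ (r ++ s)
++-mono-⊆ {a} {b} {p} {r} {q} p⊆r q⊆s {u} u∈ with splitView a b u
... | left x  = x∈p⇒x↑ˡ∈p++q (p⊆r (x↑ˡ∈p++q⇒x∈p {q = q} u∈))
... | right y = y∈q⇒a↑ʳy∈p++q {p = r} (q⊆s (a↑ʳy∈p++q⇒y∈q {p = p} u∈))

dropMembers : ∀ {n} → ℕ → Subset n → Subset n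
dropMembers zero    v           = v
dropMembers (suc j) []          = []
dropMembers (suc j) (true ∷ v)  = false ∷ dropMembers j v
dropMembers (suc j) (false ∷ v) = false ∷ dropMembers (suc j) v

takeMembers : ∀ {n} → ℕ → Subset n → Subset n
takeMembers zero    v           = ⊥
takeMembers (suc j) []          = []
takeMembers (suc j) (true ∷ v)  = true ∷ takeMembers j v
takeMembers (suc j) (false ∷ v) = false ∷ takeMembers (suc j) v

∣dropMembers∣ : ∀ {n} j (v : Subset n) → ∣ dropMembers j v ∣ ≡ ∣ v ∣ ∸ j
∣dropMembers∣ zero    v           = refl
∣dropMembers∣ (suc j) []          = refl
∣dropMembers∣ (suc j) (true ∷ v)  = ∣dropMembers∣ j v
∣dropMembers∣ (suc j) (false ∷ v) = ∣dropMembers∣ (suc j) v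

∣takeMembers∣ : ∀ {n} j (v : Subset n) → ∣ takeMembers j v ∣ ≡ j ⊓ ∣ v ∣
∣takeMembers∣ {n} zero v          = ∣⊥∣≡0 n
∣takeMembers∣ (suc j) []          = refl
∣takeMembers∣ (suc j) (true ∷ v)  = cong suc (∣takeMembers∣ j v)
∣takeMembers∣ (suc j) (false ∷ v) = ∣takeMembers∣ (suc j) v

dropMembers-⊆ : ∀ {n} j (v : Subset n) → dropMembers j v ⊆ v
dropMembers-⊆ zero    v           = λ x∈ → x∈
dropMembers-⊆ (suc j) []          = λ x∈ → x∈
dropMembers-⊆ (suc j) (true ∷ v)  = out⊆ (dropMembers-⊆ j v)
dropMembers-⊆ (suc j) (false ∷ v) = out⊆ (dropMembers-⊆ (suc j) v)

takeMembers-⊆ : ∀ {n} j (v : Subset n) → takeMembers j v ⊆ v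
takeMembers-⊆ zero    v           = λ x∈ → contradiction x∈ ∉⊥
takeMembers-⊆ (suc j) []          = λ x∈ → x∈
takeMembers-⊆ (suc j) (true ∷ v)  = s⊆s (takeMembers-⊆ j v)
takeMembers-⊆ (suc j) (false ∷ v) = out⊆ (takeMembers-⊆ (suc j) v)

dropMembers-antimono : ∀ {n i j} → i ≤ j → (v : Subset n) → dropMembers j v ⊆ dropMembers i v
dropMembers-antimono {j = j} z≤n v                   = dropMembers-⊆ j v
dropMembers-antimono (s≤s i≤j) []          = λ x∈ → x∈
dropMembers-antimono (s≤s i≤j) (true ∷ v)  = out⊆ (dropMembers-antimono i≤j v)
dropMembers-antimono (s≤s i≤j) (false ∷ v) = out⊆ (dropMembers-antimono (s≤s i≤j) v)

takeMembers-mono : ∀ {n i j} → i ≤ j → (v : Subset n) → takeMembers i v ⊆ takeMembers j v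
takeMembers-mono z≤n       v           = λ x∈ → contradiction x∈ ∉⊥
takeMembers-mono (s≤s i≤j) []          = λ x∈ → x∈
takeMembers-mono (s≤s i≤j) (true ∷ v)  = s⊆s (takeMembers-mono i≤j v)
takeMembers-mono (s≤s i≤j) (false ∷ v) = out⊆ (takeMembers-mono (s≤s i≤j) v)

∈dropMembers⇒j<∣v∣ : ∀ {n} {x : Fin n} j (v : Subset n) → x ∈ dropMembers j v → j < ∣ v ∣
∈dropMembers⇒j<∣v∣ j v x∈ = m∸n≢0⇒n<m λ ∣v∣∸j≡0 →
  <⇒≢ (x∈p⇒0<∣p∣ x∈) (sym (trans (∣dropMembers∣ j v) ∣v∣∸j≡0))

∈takeMembers⇒0<j : ∀ {n} {x : Fin n} j (v : Subset n) → x ∈ takeMembers j v → 0 < j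
∈takeMembers⇒0<j j v x∈ = ≤-trans (x∈p⇒0<∣p∣ x∈) (≤-trans (≤-reflexive (∣takeMembers∣ j v)) (m⊓n≤m j ∣ v ∣))

takeMembers-all : ∀ {n} j (v : Subset n) → ∣ v ∣ ≤ j → takeMembers j v ≡ v
takeMembers-all j v ∣v∣≤j = p⊆q∧∣q∣≤∣p∣⇒p≡q (takeMembers-⊆ j v)
  (≤-reflexive (sym (trans (∣takeMembers∣ j v) (m≥n⇒m⊓n≡n ∣v∣≤j))))

interval : (M : ℕ) → ℕ → ℕ → Subset M
interval zero    lo      hi      = []
interval (suc M) zero    zero    = false ∷ interval M 0 0
interval (suc M) zero    (suc h) = true ∷ interval M 0 h
interval (suc M) (suc l) zero    = false ∷ interval M l 0
interval (suc M) (suc l) (suc h) = false ∷ interval M l h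

∣interval∣ : ∀ M lo hi → ∣ interval M lo hi ∣ ≡ (hi ⊓ M) ∸ lo
∣interval∣ zero    lo      zero    = sym (0∸n≡0 lo)
∣interval∣ zero    lo      (suc h) = sym (0∸n≡0 lo)
∣interval∣ (suc M) zero    zero    = ∣interval∣ M 0 0
∣interval∣ (suc M) zero    (suc h) = cong suc (∣interval∣ M 0 h)
∣interval∣ (suc M) (suc l) zero    = trans (∣interval∣ M l 0) (0∸n≡0 l)
∣interval∣ (suc M) (suc l) (suc h) = ∣interval∣ M l h

∈-interval⁻ : ∀ M lo hi {q : Fin M} → q ∈ interval M lo hi → lo ≤ toℕ q × toℕ q < hi
∈-interval⁻ (suc M) zero    (suc h) {zero}  here              = z≤n , s≤s z≤n
∈-interval⁻ (suc M) zero    zero    {suc q} (there q∈) with () ← proj₂ (∈-interval⁻ M 0 0 q∈)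
∈-interval⁻ (suc M) zero    (suc h) {suc q} (there q∈) = z≤n , s≤s (proj₂ (∈-interval⁻ M 0 h q∈))
∈-interval⁻ (suc M) (suc l) zero    {suc q} (there q∈) with () ← proj₂ (∈-interval⁻ M l 0 q∈)
∈-interval⁻ (suc M) (suc l) (suc h) {suc q} (there q∈) = map s≤s s≤s (∈-interval⁻ M l h q∈)

∈-interval⁺ : ∀ M lo hi {q : Fin M} → lo ≤ toℕ q → toℕ q < hi → q ∈ interval M lo hi
∈-interval⁺ (suc M) zero    (suc h) {zero}  _         _         = here
∈-interval⁺ (suc M) zero    (suc h) {suc q} _         (s≤s q<h) = there (∈-interval⁺ M 0 h z≤n q<h)
∈-interval⁺ (suc M) (suc l) (suc h) {suc q} (s≤s l≤q) (s≤s q<h) = there (∈-interval⁺ M l h l≤q q<h)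

minimum-member : ∀ {n} (p : Subset n) {x} → x ∈ p → Σ (Fin n) λ y → y ∈ p × (∀ {z} → z ∈ p → toℕ y ≤ toℕ z)
minimum-member (true ∷ p)  _               = zero , here , λ _ → z≤n
minimum-member (false ∷ p) (there x∈p) with minimum-member p x∈p
... | y , y∈p , y≤ = suc y , there y∈p , λ { (there z∈p) → s≤s (y≤ z∈p) }

maximum-member : ∀ {n} (p : Subset n) {x} → x ∈ p → Σ (Fin n) λ y → y ∈ p × (∀ {z} → z ∈ p → toℕ z ≤ toℕ y)
maximum-member (b ∷ p) {zero} here with nonempty? p
... | no p-empty = zero , here , λ { here → z≤n ; (there z∈p) → contradiction (_ , z∈p) p-empty }
... | yes (_ , x∈p) with maximum-member p x∈p
...   | y , y∈p , ≤y = suc y , there y∈p , λ { here → z≤n ; (there z∈p) → s≤s (≤y z∈p) }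
maximum-member (b ∷ p) {suc x} (there x∈p) with maximum-member p x∈p
... | y , y∈p , ≤y = suc y , there y∈p , λ { here → z≤n ; (there z∈p) → s≤s (≤y z∈p) }

-- For k-sets T, S and M new vertices, the window at position p ≤ M + k has
-- ∣ oldPart p ∣ = k ∸ p (p ≤ M) or (p ∸ M) ⊓ k (k ≤ p), and ∣ newPart p ∣ = (p ⊓ M) ∸ (p ∸ k).

m∸n≤o⇒m≤o+n : ∀ {m n o} → m ∸ n ≤ o → m ≤ o + n
m∸n≤o⇒m≤o+n {m} {n} {o} le = ≤-trans (m≤n+m∸n m n) (≤-trans (+-monoʳ-≤ n le) (≤-reflexive (+-comm n o)))

m+2≤n+o⇒m∸n+2≤o : ∀ {m n o} → m + 2 ≤ n + o → 2 ≤ o → m ∸ n + 2 ≤ o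
m+2≤n+o⇒m∸n+2≤o {m} {n} {o} le 2≤o with n ≤? m
... | yes n≤m with m≤n⇒∃[o]m+o≡n n≤m
...   | w , refl = ≤-trans (≤-reflexive (cong (_+ 2) (m+n∸m≡n n w)))
                     (+-cancelˡ-≤ n (w + 2) o (≤-trans (≤-reflexive (sym (+-assoc n w 2))) le))
m+2≤n+o⇒m∸n+2≤o {m} {n} {o} le 2≤o | no n≰m =
  ≤-trans (≤-reflexive (cong (_+ 2) (m≤n⇒m∸n≡0 (<⇒≤ (≰⇒> n≰m))))) 2≤o

p∸[1+p∸k]≡k∸1 : ∀ {k p} → k ≤ p → p ∸ (suc p ∸ k) ≡ k ∸ 1
p∸[1+p∸k]≡k∸1 {k} k≤p with m≤n⇒∃[o]m+o≡n k≤p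
... | t , refl = begin
  k + t ∸ (suc (k + t) ∸ k)  ≡⟨ cong ((k + t) ∸_) (trans (cong (_∸ k) (sym (+-suc k t))) (m+n∸m≡n k (suc t))) ⟩
  k + t ∸ suc t              ≡⟨ cong₂ _∸_ (+-comm k t) (+-comm 1 t) ⟩
  t + k ∸ (t + 1)            ≡⟨ [m+n]∸[m+o]≡n∸o t k 1 ⟩
  k ∸ 1                      ∎
  where open ≡-Reasoning

[M+t]⊓M∸[1+M+t∸k]≡k∸[1+t] : ∀ {k M t} → k ≤ M → ((M + t) ⊓ M) ∸ (suc (M + t) ∸ k) ≡ k ∸ suc t
[M+t]⊓M∸[1+M+t∸k]≡k∸[1+t] {k} {M} {t} k≤M with m≤n⇒∃[o]m+o≡n k≤M
... | u , refl = begin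
  ((k + u + t) ⊓ (k + u)) ∸ (suc (k + u + t) ∸ k)  ≡⟨ cong₂ _∸_ (m≥n⇒m⊓n≡n (m≤m+n (k + u) t)) 1+k+u+t∸k ⟩
  k + u ∸ suc (u + t)                               ≡⟨ cong₂ _∸_ (+-comm k u) (sym (+-suc u t)) ⟩
  u + k ∸ (u + suc t)                               ≡⟨ [m+n]∸[m+o]≡n∸o u k (suc t) ⟩
  k ∸ suc t                                         ∎
  where
  open ≡-Reasoning
  1+k+u+t∸k : suc (k + u + t) ∸ k ≡ suc (u + t)
  1+k+u+t∸k = trans (cong (λ z → suc z ∸ k) (+-assoc k u t))
                    (trans (cong (_∸ k) (sym (+-suc k (u + t)))) (m+n∸m≡n k (suc (u + t))))

window-size-low : ∀ {k M p} → p ≤ M → (k ∸ p) + ((p ⊓ M) ∸ (p ∸ k)) ≡ k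
window-size-low {k} {M} {p} p≤M rewrite m≤n⇒m⊓n≡m p≤M with p ≤? k
... | yes p≤k rewrite m≤n⇒m∸n≡0 p≤k = m∸n+n≡m p≤k
... | no p≰k rewrite m≤n⇒m∸n≡0 (<⇒≤ (≰⇒> p≰k)) = m∸[m∸n]≡n (<⇒≤ (≰⇒> p≰k))

window-size-high : ∀ {k M p} → k ≤ M → M ≤ p → p ≤ M + k → ((p ∸ M) ⊓ k) + ((p ⊓ M) ∸ (p ∸ k)) ≡ k
window-size-high {k} {M} {p} k≤M M≤p p≤M+k with m≤n⇒∃[o]m+o≡n M≤p | m≤n⇒∃[o]m+o≡n k≤M
... | t , refl | u , refl = begin
  ((k + u + t) ∸ (k + u)) ⊓ k + (((k + u + t) ⊓ (k + u)) ∸ ((k + u + t) ∸ k))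
    ≡⟨ cong₂ _+_ (trans (cong (_⊓ k) (m+n∸m≡n (k + u) t)) (m≤n⇒m⊓n≡m t≤k))
                 (cong₂ _∸_ (m≥n⇒m⊓n≡n (m≤m+n (k + u) t)) (trans (cong (_∸ k) (+-assoc k u t)) (m+n∸m≡n k (u + t)))) ⟩
  t + ((k + u) ∸ (u + t))
    ≡⟨ cong (t +_) (trans (cong (_∸ (u + t)) (+-comm k u)) ([m+n]∸[m+o]≡n∸o u k t)) ⟩
  t + (k ∸ t)
    ≡⟨ m+[n∸m]≡n t≤k ⟩
  k ∎
  where
  open ≡-Reasoning
  t≤k : t ≤ k
  t≤k = +-cancelˡ-≤ (k + u) t k p≤M+k

next-overlap-size<k-low : ∀ {k M p} → 1 ≤ k → suc p ≤ M → (k ∸ suc p) + ((p ⊓ M) ∸ (suc p ∸ k)) + 1 ≤ k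
next-overlap-size<k-low {k} {M} {p} 1≤k 1+p≤M rewrite m≤n⇒m⊓n≡m (≤-trans (n≤1+n p) 1+p≤M) with suc p ≤? k
... | yes 1+p≤k rewrite m≤n⇒m∸n≡0 1+p≤k =
  ≤-reflexive (trans (trans (+-assoc (k ∸ suc p) p 1) (cong ((k ∸ suc p) +_) (+-comm p 1))) (m∸n+n≡m 1+p≤k))
... | no 1+p≰k rewrite m≤n⇒m∸n≡0 (<⇒≤ (≰⇒> 1+p≰k)) | p∸[1+p∸k]≡k∸1 {k} {p} (s≤s⁻¹ (≰⇒> 1+p≰k)) =
  ≤-reflexive (m∸n+n≡m 1≤k)

next-overlap-size<k-high : ∀ {k M p} → k ≤ M → M < suc p → suc p ≤ M + k →
  ((p ∸ M) ⊓ k) + ((p ⊓ M) ∸ (suc p ∸ k)) + 1 ≤ k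
next-overlap-size<k-high {k} {M} {p} k≤M M<1+p 1+p≤M+k with m≤n⇒∃[o]m+o≡n (s≤s⁻¹ M<1+p)
... | t , refl = bound (+-cancelˡ-≤ M (suc t) k (≤-trans (≤-reflexive (+-suc M t)) 1+p≤M+k))
  where
  bound : suc t ≤ k → ((M + t ∸ M) ⊓ k) + (((M + t) ⊓ M) ∸ (suc (M + t) ∸ k)) + 1 ≤ k
  bound 1+t≤k rewrite m+n∸m≡n M t | m≤n⇒m⊓n≡m (≤-trans (n≤1+n t) 1+t≤k)
                    | [M+t]⊓M∸[1+M+t∸k]≡k∸[1+t] {k} {M} {t} k≤M =
    ≤-reflexive (trans (+-comm (t + (k ∸ suc t)) 1) (m+[n∸m]≡n 1+t≤k))

next-overlap-size≥k∸1-low : ∀ {k M p} → suc p ≤ k → k ≤ M → k ∸ 1 ≤ (k ∸ suc p) + ((p ⊓ M) ∸ (p ∸ k))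
next-overlap-size≥k∸1-low {k} {M} {p} 1+p≤k k≤M with m≤n⇒∃[o]m+o≡n 1+p≤k
... | t , refl = ≤-reflexive (sym (trans (cong₂ _+_ (m+n∸m≡n p t)
                   (cong₂ _∸_ (m≤n⇒m⊓n≡m (≤-trans (n≤1+n p) (≤-trans 1+p≤k k≤M)))
                              (m≤n⇒m∸n≡0 (≤-trans (n≤1+n p) 1+p≤k))))
                   (+-comm t p)))

next-overlap-size≥k∸1-high : ∀ {k M p} → k ≤ M → k ≤ p → suc p ≤ M + k →
  k ∸ 1 ≤ ((p ∸ M) ⊓ k) + ((p ⊓ M) ∸ (suc p ∸ k))
next-overlap-size≥k∸1-high {k} {M} {p} k≤M k≤p 1+p≤M+k with p ≤? M
... | yes p≤M rewrite m≤n⇒m∸n≡0 p≤M | m≤n⇒m⊓n≡m p≤M = ≤-reflexive (sym (p∸[1+p∸k]≡k∸1 k≤p))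
... | no p≰M with m≤n⇒∃[o]m+o≡n (<⇒≤ (≰⇒> p≰M))
...   | t , refl = bound (+-cancelˡ-≤ M (suc t) k (≤-trans (≤-reflexive (+-suc M t)) 1+p≤M+k))
  where
  bound : suc t ≤ k → k ∸ 1 ≤ ((M + t ∸ M) ⊓ k) + (((M + t) ⊓ M) ∸ (suc (M + t) ∸ k))
  bound 1+t≤k rewrite m+n∸m≡n M t | m≤n⇒m⊓n≡m (≤-trans (n≤1+n t) 1+t≤k)
                    | [M+t]⊓M∸[1+M+t∸k]≡k∸[1+t] {k} {M} {t} k≤M =
    ≤-trans (m≤n+m∸n (k ∸ 1) t) (≤-reflexive (cong (t +_) (∸-+-assoc k 1 t)))

distant-overlap-size≤k∸2-low : ∀ {k M p q} → 2 ≤ k → p + 2 ≤ q → q ≤ M → (k ∸ q) + ((p ⊓ M) ∸ (q ∸ k)) + 2 ≤ k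
distant-overlap-size≤k∸2-low {k} {M} {p} {q} 2≤k p+2≤q q≤M
  rewrite m≤n⇒m⊓n≡m (≤-trans (m≤m+n p 2) (≤-trans p+2≤q q≤M)) with q ≤? k
... | yes q≤k rewrite m≤n⇒m∸n≡0 q≤k = begin
  k ∸ q + p + 2    ≡⟨ +-assoc (k ∸ q) p 2 ⟩
  k ∸ q + (p + 2)  ≤⟨ +-monoʳ-≤ (k ∸ q) p+2≤q ⟩
  k ∸ q + q        ≡⟨ m∸n+n≡m q≤k ⟩
  k                ∎
  where open ≤-Reasoning
... | no q≰k rewrite m≤n⇒m∸n≡0 (<⇒≤ (≰⇒> q≰k)) =
  m+2≤n+o⇒m∸n+2≤o (≤-trans p+2≤q (≤-reflexive (sym (m∸n+n≡m (<⇒≤ (≰⇒> q≰k)))))) 2≤k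

distant-overlap-size≤k∸2-high : ∀ {k M p q} → 2 ≤ k → k ≤ p → p + 2 ≤ q → q ≤ M + k →
  ((p ∸ M) ⊓ k) + ((p ⊓ M) ∸ (q ∸ k)) + 2 ≤ k
distant-overlap-size≤k∸2-high {k} {M} {p} {q} 2≤k k≤p p+2≤q q≤M+k with p ≤? M
... | yes p≤M rewrite m≤n⇒m∸n≡0 p≤M | m≤n⇒m⊓n≡m p≤M =
  m+2≤n+o⇒m∸n+2≤o (≤-trans p+2≤q (≤-reflexive (sym (m∸n+n≡m k≤q)))) 2≤k
  where
  k≤q : k ≤ q
  k≤q = ≤-trans k≤p (≤-trans (m≤m+n p 2) p+2≤q)
... | no p≰M with m≤n⇒∃[o]m+o≡n (<⇒≤ (≰⇒> p≰M))
...   | t , refl with m≤n⇒∃[o]m+o≡n (m≤n+o⇒m∸n≤o q k (≤-trans q≤M+k (≤-reflexive (+-comm M k))))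
...     | v , M≡ = +-cancelʳ-≤ (q ∸ k) _ k (begin
  (M + t ∸ M) ⊓ k + ((M + t) ⊓ M ∸ (q ∸ k)) + 2 + (q ∸ k)
    ≡⟨ cong (λ z → z + ((M + t) ⊓ M ∸ (q ∸ k)) + 2 + (q ∸ k))
            (trans (cong (_⊓ k) (m+n∸m≡n M t)) (m≤n⇒m⊓n≡m t≤k)) ⟩
  t + ((M + t) ⊓ M ∸ (q ∸ k)) + 2 + (q ∸ k)
    ≡⟨ cong (λ z → t + (z ∸ (q ∸ k)) + 2 + (q ∸ k)) (trans (m≥n⇒m⊓n≡n (m≤m+n M t)) (sym M≡)) ⟩
  t + ((q ∸ k) + v ∸ (q ∸ k)) + 2 + (q ∸ k)
    ≡⟨ cong (λ z → t + z + 2 + (q ∸ k)) (m+n∸m≡n (q ∸ k) v) ⟩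
  t + v + 2 + (q ∸ k)
    ≡⟨ solve 3 (λ t v a → t :+ v :+ con 2 :+ a := a :+ v :+ t :+ con 2) refl t v (q ∸ k) ⟩
  (q ∸ k) + v + t + 2
    ≡⟨ cong (λ z → z + t + 2) M≡ ⟩
  M + t + 2
    ≤⟨ p+2≤q ⟩
  q
    ≡⟨ sym (m∸n+n≡m k≤q) ⟩
  q ∸ k + k
    ≡⟨ +-comm (q ∸ k) k ⟩
  k + (q ∸ k) ∎)
  where
  open ≤-Reasoning
  open +-*-Solver
  k≤q : k ≤ q
  k≤q = ≤-trans k≤p (≤-trans (m≤m+n (M + t) 2) p+2≤q)
  t≤k : t ≤ k
  t≤k = +-cancelˡ-≤ M t k (≤-trans (m≤m+n (M + t) 2) (≤-trans p+2≤q q≤M+k))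

distant-newParts-size≡0 : ∀ {k M p q} → p < k → M < q → k + k ≤ M + 1 → (p ⊓ M) ∸ (q ∸ k) ≡ 0
distant-newParts-size≡0 {k} {M} {p} {q} p<k M<q k+k≤M+1 =
  m≤n⇒m∸n≡0 (≤-trans (m⊓n≤m p M) (m+n≤o⇒m≤o∸n p (<⇒≤ p+k<q)))
  where
  open ≤-Reasoning
  p+k<q : p + k < q
  p+k<q = begin-strict
    p + k  <⟨ +-monoˡ-< k p<k ⟩
    k + k  ≤⟨ k+k≤M+1 ⟩
    M + 1  ≡⟨ +-comm M 1 ⟩
    suc M  ≤⟨ M<q ⟩
    q      ∎

k∸1≤k∸p⇒p≡1 : ∀ {k p} → 1 ≤ p → 2 ≤ k → k ∸ 1 ≤ k ∸ p → p ≡ 1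
k∸1≤k∸p⇒p≡1 {k}           {suc zero}    _ _           _  = refl
k∸1≤k∸p⇒p≡1 {suc zero}    {suc (suc p)} _ (s≤s ())    _
k∸1≤k∸p⇒p≡1 {suc (suc k)} {suc (suc p)} _ _           le = contradiction (≤-trans le (m∸n≤m k p)) (<⇒≱ ≤-refl)

k∸1≤[p∸M]⊓k⇒1+p≡M+k : ∀ {k M p} → M < p → p < M + k → k ∸ 1 ≤ (p ∸ M) ⊓ k → suc p ≡ M + k
k∸1≤[p∸M]⊓k⇒1+p≡M+k {k} {M} {p} M<p p<M+k le with m≤n⇒∃[o]m+o≡n (<⇒≤ M<p)
... | t , refl = trans (sym (+-suc M t)) (cong (M +_) (≤-antisym 1+t≤k k≤1+t))
  where
  1+t≤k : suc t ≤ k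
  1+t≤k = +-cancelˡ-≤ M (suc t) k (≤-trans (≤-reflexive (+-suc M t)) p<M+k)
  k≤1+t : k ≤ suc t
  k≤1+t = ≤-trans (m≤n+m∸n k 1) (s≤s (≤-trans le (≤-trans (≤-reflexive (cong (_⊓ k) (m+n∸m≡n M t))) (m⊓n≤m t k))))

1+q≤k⇒q+k∸M≡0 : ∀ {k M q} → suc q ≤ k → k + k ≤ M + 1 → q + k ∸ M ≡ 0
1+q≤k⇒q+k∸M≡0 {k} {M} {q} 1+q≤k k+k≤M+1 = m≤n⇒m∸n≡0 (s≤s⁻¹ (begin
  suc (q + k)  ≤⟨ +-monoˡ-≤ k 1+q≤k ⟩
  k + k        ≤⟨ k+k≤M+1 ⟩
  M + 1        ≡⟨ +-comm M 1 ⟩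
  suc M        ∎))
  where open ≤-Reasoning

slot-of-max-new-vertex-avoids-S : ∀ {k M q₀ q₁} → 2 + q₀ ≤ k → q₁ < k + q₀ → k + k + k ≤ M + 2 → q₁ + k ≤ M
slot-of-max-new-vertex-avoids-S {k} {M} {q₀} {q₁} 2+q₀≤k q₁<k+q₀ 3k≤M+2 =
  <⇒≤ (+-cancelʳ-≤ (2 + q₀) (suc (q₁ + k)) M (begin
    suc (q₁ + k) + (2 + q₀)  ≡⟨ solve 3 (λ k q₀ q₁ → con 1 :+ (q₁ :+ k) :+ (con 2 :+ q₀)
                                                  := (con 1 :+ q₁) :+ (con 2 :+ q₀) :+ k) refl k q₀ q₁ ⟩
    suc q₁ + (2 + q₀) + k    ≤⟨ +-monoˡ-≤ k (+-mono-≤ q₁<k+q₀ 2+q₀≤k) ⟩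
    k + q₀ + k + k           ≡⟨ solve 2 (λ k q₀ → k :+ q₀ :+ k :+ k := k :+ k :+ k :+ q₀) refl k q₀ ⟩
    k + k + k + q₀           ≤⟨ +-monoˡ-≤ q₀ 3k≤M+2 ⟩
    M + 2 + q₀               ≡⟨ +-assoc M 2 q₀ ⟩
    M + (2 + q₀)             ∎))
  where
  open ≤-Reasoning
  open +-*-Solver

interior-newPart-nonempty : ∀ {k M p} → 1 ≤ k → k ≤ M → 1 ≤ p → p < M + k → 1 ≤ (p ⊓ M) ∸ (p ∸ k)
interior-newPart-nonempty {k} {M} {p} 1≤k k≤M 1≤p p<M+k with k ≤? p
... | no k≰p rewrite m≤n⇒m∸n≡0 (<⇒≤ (≰⇒> k≰p)) = ⊓-pres-m< 1≤p (≤-trans 1≤k k≤M)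
... | yes k≤p with m≤n⇒∃[o]m+o≡n k≤p
...   | t , refl rewrite m+n∸m≡n k t =
  m<n⇒0<n∸m (⊓-pres-m< (≤-trans (s≤s (m≤n+m t (k ∸ 1))) (≤-reflexive (cong (_+ t) (m+[n∸m]≡n 1≤k)))) t<M)
  where
  t<M : t < M
  t<M = +-cancelˡ-≤ k (suc t) M (≤-trans (≤-reflexive (+-suc k t)) (≤-trans p<M+k (≤-reflexive (+-comm M k))))

k+k+k≤[3k∸2]+2 : ∀ {k} → 3 ≤ k → k + k + k ≤ (3 * k ∸ 2) + 2
k+k+k≤[3k∸2]+2 {k} 3≤k = ≤-reflexive (sym (trans (m∸n+n≡m 2≤3k) (solve 1 (λ k → con 3 :* k := k :+ k :+ k) refl k)))
  where
  open +-*-Solver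
  2≤3k : 2 ≤ 3 * k
  2≤3k = ≤-trans (≤-trans (n≤1+n 2) 3≤k) (m≤n*m k 3)

2+[4k∸4]≡[3k∸2]+k : ∀ {k} → 3 ≤ k → 2 + (4 * k ∸ 4) ≡ (3 * k ∸ 2) + k
2+[4k∸4]≡[3k∸2]+k {k} 3≤k = +-cancelʳ-≡ 2 _ _ (begin
  2 + (4 * k ∸ 4) + 2      ≡⟨ solve 1 (λ a → con 2 :+ a :+ con 2 := a :+ con 4) refl (4 * k ∸ 4) ⟩
  (4 * k ∸ 4) + 4          ≡⟨ m∸n+n≡m (*-monoʳ-≤ 4 (≤-trans (s≤s z≤n) 3≤k)) ⟩
  4 * k                    ≡⟨ solve 1 (λ k → con 4 :* k := con 3 :* k :+ k) refl k ⟩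
  3 * k + k                ≡⟨ cong (_+ k) (sym (m∸n+n≡m (≤-trans (≤-trans (n≤1+n 2) 3≤k) (m≤n*m k 3)))) ⟩
  (3 * k ∸ 2) + 2 + k      ≡⟨ solve 2 (λ b k → b :+ con 2 :+ k := b :+ k :+ con 2) refl (3 * k ∸ 2) k ⟩
  (3 * k ∸ 2) + k + 2      ∎)
  where
  open ≡-Reasoning
  open +-*-Solver

module _ {m : ℕ} {H : Graph m} {k : ℕ} where

  walk-++ : ∀ {a b I J K} → Walk H k a I J → Walk H k b J K → Walk H k (a + b) I K
  walk-++ (nil _)    w = w
  walk-++ (cons x v) w = cons x (walk-++ v w)

  walk-map : ∀ {m′} {H′ : Graph m′} (f : Subset m → Subset m′) →
             (∀ {I} → IsKIS H k I → IsKIS H′ k (f I)) →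
             (∀ {I J} → ConfAdj H k I J → ConfAdj H′ k (f I) (f J)) →
             ∀ {a I J} → Walk H k a I J → Walk H′ k a (f I) (f J)
  walk-map f f-KIS f-adj (nil I-KIS)  = nil (f-KIS I-KIS)
  walk-map f f-KIS f-adj (cons IJ w)  = cons (f-adj IJ) (walk-map f f-KIS f-adj w)

  overlap⇒≡⊎adjacent : ∀ {I J} → IsKIS H k I → IsKIS H k J → k ∸ 1 ≤ ∣ I ∩ J ∣ → I ≡ J ⊎ ConfAdj H k I J
  overlap⇒≡⊎adjacent {I} {J} I-KIS J-KIS ≤∣I∩J∣ with ∣ I ∩ J ∣ ≟ k
  ... | yes ∣I∩J∣≡k = inj₁ (p⊆q∧∣q∣≤∣p∣⇒p≡q I⊆J (≤-reflexive (trans (proj₂ J-KIS) (sym (proj₂ I-KIS)))))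
    where
    I∩J≡I : I ∩ J ≡ I
    I∩J≡I = p⊆q∧∣q∣≤∣p∣⇒p≡q (p∩q⊆p I J) (≤-reflexive (trans (proj₂ I-KIS) (sym ∣I∩J∣≡k)))
    I⊆J : I ⊆ J
    I⊆J x∈I = p∩q⊆q I J (subst (_ ∈_) (sym I∩J≡I) x∈I)
  ... | no ∣I∩J∣≢k = inj₂ (I-KIS , J-KIS , ≤-antisym ∣I∩J∣≤k∸1 ≤∣I∩J∣)
    where
    ∣I∩J∣≤k∸1 : ∣ I ∩ J ∣ ≤ k ∸ 1
    ∣I∩J∣≤k∸1 = subst (∣ I ∩ J ∣ ≤_) (pred[m∸n]≡m∸[1+n] k 0)
                  (<⇒≤pred (≤∧≢⇒< (≤-trans (∣p∩q∣≤∣p∣ I J) (≤-reflexive (proj₂ I-KIS))) ∣I∩J∣≢k))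

  overlap⇒walk≤1 : ∀ {I J} → IsKIS H k I → IsKIS H k J → k ∸ 1 ≤ ∣ I ∩ J ∣ → Σ ℕ λ b → b ≤ 1 × Walk H k b I J
  overlap⇒walk≤1 I-KIS J-KIS ≤∣I∩J∣ with overlap⇒≡⊎adjacent I-KIS J-KIS ≤∣I∩J∣
  ... | inj₁ refl = 0 , z≤n , nil I-KIS
  ... | inj₂ IJ   = 1 , ≤-refl , cons IJ (nil J-KIS)

-- The gadget joining two k-sets

-- New vertex q misses exactly the old vertices in its slot, and new vertices q, r are adjacent iff
-- they are at least k apart.  The window at position p (old part plus the new vertices in
-- [p ∸ k, p)) is then independent, and windows 0, 1, …, M + k form a path from T to S.
module Gadget {x : ℕ} (X : Graph x) (k M : ℕ) (T S : Subset x)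
              (2≤k : 2 ≤ k) (3k≤M+2 : k + k + k ≤ M + 2)
              (T-KIS : IsKIS X k T) (S-KIS : IsKIS X k S) where

  1≤k : 1 ≤ k
  1≤k = ≤-trans (s≤s z≤n) 2≤k

  k+k≤M : k + k ≤ M
  k+k≤M = +-cancelʳ-≤ 2 (k + k) M (≤-trans (+-monoʳ-≤ (k + k) 2≤k) 3k≤M+2)

  k≤M : k ≤ M
  k≤M = ≤-trans (m≤m+n k k) k+k≤M

  k+k≤M+1 : k + k ≤ M + 1
  k+k≤M+1 = ≤-trans k+k≤M (m≤m+n M 1)

  ∣T∣≡k : ∣ T ∣ ≡ k
  ∣T∣≡k = proj₂ T-KIS

  ∣S∣≡k : ∣ S ∣ ≡ k
  ∣S∣≡k = proj₂ S-KIS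

  slot : ℕ → Subset x
  slot q = dropMembers (suc q) T ∪ takeMembers (q + k ∸ M) S

  far : ℕ → ℕ → Bool
  far q r = does (k + q ≤? r) ∨ does (k + r ≤? q)

  far-sym : ∀ q r → far q r ≡ far r q
  far-sym q r = ∨-comm (does (k + q ≤? r)) (does (k + r ≤? q))

  far≡false⇒< : ∀ q r → far q r ≡ false → r < k + q
  far≡false⇒< q r far≡false = ≰⇒> λ k+q≤r →
    contradiction (trans (sym (dec-true (k + q ≤? r) k+q≤r)) (∨-conicalˡ _ _ far≡false)) λ ()

  <⇒far≡false : ∀ q r → r < k + q → q < k + r → far q r ≡ false
  <⇒far≡false q r r<k+q q<k+r =
    cong₂ _∨_ (dec-false (k + q ≤? r) (<⇒≱ r<k+q)) (dec-false (k + r ≤? q) (<⇒≱ q<k+r))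

  adjacency : Fin x ⊎ Fin M → Fin x ⊎ Fin M → Bool
  adjacency (inj₁ a) (inj₁ b) = Adj X a b
  adjacency (inj₁ a) (inj₂ q) = not (lookup (slot (toℕ q)) a)
  adjacency (inj₂ q) (inj₁ a) = not (lookup (slot (toℕ q)) a)
  adjacency (inj₂ q) (inj₂ r) = far (toℕ q) (toℕ r)

  adjacency-sym : ∀ u v → adjacency u v ≡ adjacency v u
  adjacency-sym (inj₁ a) (inj₁ b) = Graph.sym X a b
  adjacency-sym (inj₁ a) (inj₂ q) = refl
  adjacency-sym (inj₂ q) (inj₁ a) = refl
  adjacency-sym (inj₂ q) (inj₂ r) = far-sym (toℕ q) (toℕ r)

  adjacency-irrefl : ∀ u → adjacency u u ≡ false
  adjacency-irrefl (inj₁ a) = irrefl X a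
  adjacency-irrefl (inj₂ q) = <⇒far≡false (toℕ q) (toℕ q) q<k+q q<k+q
    where
    q<k+q : toℕ q < k + toℕ q
    q<k+q = +-monoˡ-≤ (toℕ q) 1≤k

  joined : Graph (x + M)
  joined = record
    { Adj    = λ u v → adjacency (splitAt x u) (splitAt x v)
    ; sym    = λ u v → adjacency-sym (splitAt x u) (splitAt x v)
    ; irrefl = λ u → adjacency-irrefl (splitAt x u)
    }

  Adj-old-old : ∀ a b → Adj joined (a ↑ˡ M) (b ↑ˡ M) ≡ Adj X a b
  Adj-old-old a b rewrite splitAt-↑ˡ x a M | splitAt-↑ˡ x b M = refl

  Adj-old-new : ∀ a q → Adj joined (a ↑ˡ M) (x ↑ʳ q) ≡ not (lookup (slot (toℕ q)) a)
  Adj-old-new a q rewrite splitAt-↑ˡ x a M | splitAt-↑ʳ x M q = refl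

  Adj-new-old : ∀ q a → Adj joined (x ↑ʳ q) (a ↑ˡ M) ≡ not (lookup (slot (toℕ q)) a)
  Adj-new-old q a rewrite splitAt-↑ˡ x a M | splitAt-↑ʳ x M q = refl

  Adj-new-new : ∀ q r → Adj joined (x ↑ʳ q) (x ↑ʳ r) ≡ far (toℕ q) (toℕ r)
  Adj-new-new q r rewrite splitAt-↑ʳ x M q | splitAt-↑ʳ x M r = refl

  record IndependentParts (o : Subset x) (g : Subset M) : Set where
    field
      old-independent : Independent X k o
      old⊆slot        : ∀ {a q} → a ∈ o → q ∈ g → a ∈ slot (toℕ q)
      new-close       : ∀ {q r} → q ∈ g → r ∈ g → far (toℕ q) (toℕ r) ≡ false
  open IndependentParts

  independent⇒parts : ∀ {o g} → Independent joined k (o ++ g) → IndependentParts o g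
  independent⇒parts {o} {g} ind = record
    { old-independent = λ a b a∈ b∈ → trans (sym (Adj-old-old a b)) (ind _ _ (old a∈) (old b∈))
    ; old⊆slot        = λ {a} {q} a∈ q∈ → lookup⇒[]= a _
                          (not-injective (trans (sym (Adj-old-new a q)) (ind _ _ (old a∈) (new q∈))))
    ; new-close       = λ {q} {r} q∈ r∈ → trans (sym (Adj-new-new q r)) (ind _ _ (new q∈) (new r∈))
    }
    where
    old : ∀ {a} → a ∈ o → (a ↑ˡ M) ∈ (o ++ g)
    old = x∈p⇒x↑ˡ∈p++q
    new : ∀ {q} → q ∈ g → (x ↑ʳ q) ∈ (o ++ g)
    new = y∈q⇒a↑ʳy∈p++q {p = o}

  parts⇒independent : ∀ {o g} → IndependentParts o g → Independent joined k (o ++ g)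
  parts⇒independent {o} {g} P u v = by-cases (splitView x M u) (splitView x M v)
    where
    old : ∀ {a} → (a ↑ˡ M) ∈ (o ++ g) → a ∈ o
    old = x↑ˡ∈p++q⇒x∈p {q = g}
    new : ∀ {q} → (x ↑ʳ q) ∈ (o ++ g) → q ∈ g
    new = a↑ʳy∈p++q⇒y∈q {p = o}
    by-cases : ∀ {u v} → SplitView x M u → SplitView x M v → u ∈ (o ++ g) → v ∈ (o ++ g) → Adj joined u v ≡ false
    by-cases (left a)  (left b)  u∈ v∈ = trans (Adj-old-old a b) (old-independent P a b (old u∈) (old v∈))
    by-cases (left a)  (right q) u∈ v∈ = trans (Adj-old-new a q) (cong not ([]=⇒lookup (old⊆slot P (old u∈) (new v∈))))
    by-cases (right q) (left a)  u∈ v∈ = trans (Adj-new-old q a) (cong not ([]=⇒lookup (old⊆slot P (old v∈) (new u∈))))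
    by-cases (right q) (right r) u∈ v∈ = trans (Adj-new-new q r) (new-close P (new u∈) (new v∈))

  oldPart : ℕ → Subset x
  oldPart p = dropMembers p T ∪ takeMembers (p ∸ M) S

  newPart : ℕ → Subset M
  newPart p = interval M (p ∸ k) p

  window : ℕ → Subset (x + M)
  window p = oldPart p ++ newPart p

  oldPart⊆T : ∀ {p} → p ≤ M → oldPart p ⊆ T
  oldPart⊆T {p} p≤M a∈ with x∈p∪q⁻ (dropMembers p T) (takeMembers (p ∸ M) S) a∈
  ... | inj₁ a∈T = dropMembers-⊆ p T a∈T
  ... | inj₂ a∈S = contradiction (≤-reflexive (m≤n⇒m∸n≡0 p≤M)) (<⇒≱ (∈takeMembers⇒0<j (p ∸ M) S a∈S))

  oldPart⊆S : ∀ {p} → k ≤ p → oldPart p ⊆ S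
  oldPart⊆S {p} k≤p a∈ with x∈p∪q⁻ (dropMembers p T) (takeMembers (p ∸ M) S) a∈
  ... | inj₁ a∈T = contradiction k≤p (<⇒≱ (subst (p <_) ∣T∣≡k (∈dropMembers⇒j<∣v∣ p T a∈T)))
  ... | inj₂ a∈S = takeMembers-⊆ (p ∸ M) S a∈S

  oldPart-≤M : ∀ {p} → p ≤ M → oldPart p ≡ dropMembers p T
  oldPart-≤M {p} p≤M rewrite m≤n⇒m∸n≡0 p≤M = ∪-identityʳ (dropMembers p T)

  oldPart-≥k : ∀ {p} → k ≤ p → oldPart p ≡ takeMembers (p ∸ M) S
  oldPart-≥k {p} k≤p =
    trans (cong (_∪ takeMembers (p ∸ M) S) (∣p∣≡0⇒p≡⊥ ∣dropMembers-T∣≡0)) (∪-identityˡ (takeMembers (p ∸ M) S))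
    where
    ∣dropMembers-T∣≡0 : ∣ dropMembers p T ∣ ≡ 0
    ∣dropMembers-T∣≡0 = trans (∣dropMembers∣ p T) (trans (cong (_∸ p) ∣T∣≡k) (m≤n⇒m∸n≡0 k≤p))

  ∣oldPart∣-≤M : ∀ {p} → p ≤ M → ∣ oldPart p ∣ ≡ k ∸ p
  ∣oldPart∣-≤M {p} p≤M rewrite oldPart-≤M p≤M = trans (∣dropMembers∣ p T) (cong (_∸ p) ∣T∣≡k)

  ∣oldPart∣-≥k : ∀ {p} → k ≤ p → ∣ oldPart p ∣ ≡ (p ∸ M) ⊓ k
  ∣oldPart∣-≥k {p} k≤p rewrite oldPart-≥k k≤p = trans (∣takeMembers∣ (p ∸ M) S) (cong ((p ∸ M) ⊓_) ∣S∣≡k)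

  ∣newPart∣ : ∀ p → ∣ newPart p ∣ ≡ (p ⊓ M) ∸ (p ∸ k)
  ∣newPart∣ p = ∣interval∣ M (p ∸ k) p

  ∣window∣ : ∀ {p} → p ≤ M + k → ∣ window p ∣ ≡ k
  ∣window∣ {p} p≤M+k with p ≤? M
  ... | yes p≤M = trans (∣p++q∣≡∣p∣+∣q∣ (oldPart p) (newPart p))
                    (trans (cong₂ _+_ (∣oldPart∣-≤M p≤M) (∣newPart∣ p)) (window-size-low p≤M))
  ... | no p≰M  = trans (∣p++q∣≡∣p∣+∣q∣ (oldPart p) (newPart p))
                    (trans (cong₂ _+_ (∣oldPart∣-≥k (≤-trans k≤M M≤p)) (∣newPart∣ p)) (window-size-high k≤M M≤p p≤M+k))
    where
    M≤p : M ≤ p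
    M≤p = <⇒≤ (≰⇒> p≰M)

  window-independent : ∀ p → Independent joined k (window p)
  window-independent p = parts⇒independent record
    { old-independent = oldPart-independent
    ; old⊆slot        = oldPart⊆slots
    ; new-close       = newPart-close
    }
    where
    oldPart-independent : Independent X k (oldPart p)
    oldPart-independent a b a∈ b∈ with p ≤? M
    ... | yes p≤M = proj₁ T-KIS a b (oldPart⊆T p≤M a∈) (oldPart⊆T p≤M b∈)
    ... | no p≰M  = proj₁ S-KIS a b (oldPart⊆S k≤p a∈) (oldPart⊆S k≤p b∈)
      where
      k≤p : k ≤ p
      k≤p = ≤-trans k≤M (<⇒≤ (≰⇒> p≰M))
    oldPart⊆slots : ∀ {a q} → a ∈ oldPart p → q ∈ newPart p → a ∈ slot (toℕ q)
    oldPart⊆slots {a} {q} a∈ q∈ with ∈-interval⁻ M (p ∸ k) p q∈ | x∈p∪q⁻ (dropMembers p T) (takeMembers (p ∸ M) S) a∈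
    ... | _ , q<p | inj₁ a∈T = x∈p∪q⁺ (inj₁ (dropMembers-antimono q<p T a∈T))
    ... | p∸k≤q , _ | inj₂ a∈S = x∈p∪q⁺ (inj₂ (takeMembers-mono (∸-monoˡ-≤ M (m∸n≤o⇒m≤o+n p∸k≤q)) S a∈S))
    newPart-close : ∀ {q r} → q ∈ newPart p → r ∈ newPart p → far (toℕ q) (toℕ r) ≡ false
    newPart-close {q} {r} q∈ r∈ with ∈-interval⁻ M (p ∸ k) p q∈ | ∈-interval⁻ M (p ∸ k) p r∈
    ... | p∸k≤q , q<p | p∸k≤r , r<p = <⇒far≡false (toℕ q) (toℕ r)
      (≤-trans r<p (≤-trans (m∸n≤o⇒m≤o+n p∸k≤q) (≤-reflexive (+-comm (toℕ q) k))))
      (≤-trans q<p (≤-trans (m∸n≤o⇒m≤o+n p∸k≤r) (≤-reflexive (+-comm (toℕ r) k))))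

  window-KIS : ∀ {p} → p ≤ M + k → IsKIS joined k (window p)
  window-KIS {p} p≤M+k = window-independent p , ∣window∣ p≤M+k

  window-first : window 0 ≡ T ++ ⊥
  window-first = cong₂ _++_ (oldPart-≤M z≤n) (∣p∣≡0⇒p≡⊥ (trans (∣newPart∣ 0) (0∸n≡0 (0 ∸ k))))

  window-last : window (M + k) ≡ S ++ ⊥
  window-last = cong₂ _++_ oldPart≡S newPart≡⊥
    where
    oldPart≡S : oldPart (M + k) ≡ S
    oldPart≡S = trans (oldPart-≥k (m≤n+m k M))
                  (trans (cong (λ j → takeMembers j S) (m+n∸m≡n M k)) (takeMembers-all k S (≤-reflexive ∣S∣≡k)))
    newPart≡⊥ : newPart (M + k) ≡ ⊥
    newPart≡⊥ = ∣p∣≡0⇒p≡⊥ (trans (∣newPart∣ (M + k))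
                  (trans (cong₂ _∸_ (m≥n⇒m⊓n≡n (m≤m+n M k)) (m+n∸n≡m M k)) (n∸n≡0 M)))

  ∣window∩window∣ : ∀ p q → ∣ window p ∩ window q ∣ ≡ ∣ oldPart p ∩ oldPart q ∣ + ∣ newPart p ∩ newPart q ∣
  ∣window∩window∣ p q = trans (cong ∣_∣ (++-∩-++ (oldPart p) (oldPart q) (newPart p) (newPart q)))
                              (∣p++q∣≡∣p∣+∣q∣ (oldPart p ∩ oldPart q) (newPart p ∩ newPart q))

  ∣window∩window∣-≥ : ∀ {p q} {A : Subset x} {B : Subset M} → A ⊆ oldPart p ∩ oldPart q → B ⊆ newPart p ∩ newPart q →
                      ∣ A ∣ + ∣ B ∣ ≤ ∣ window p ∩ window q ∣
  ∣window∩window∣-≥ {p} {q} A⊆ B⊆ =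
    ≤-trans (+-mono-≤ (p⊆q⇒∣p∣≤∣q∣ A⊆) (p⊆q⇒∣p∣≤∣q∣ B⊆)) (≤-reflexive (sym (∣window∩window∣ p q)))

  ∣window∩window∣-≤ : ∀ {p q a b} → ∣ oldPart p ∩ oldPart q ∣ ≤ a → ∣ newPart p ∩ newPart q ∣ ≤ b →
                      ∣ window p ∩ window q ∣ ≤ a + b
  ∣window∩window∣-≤ {p} {q} ≤a ≤b = ≤-trans (≤-reflexive (∣window∩window∣ p q)) (+-mono-≤ ≤a ≤b)

  ∣newPart∩newPart∣ : ∀ p q → ∣ newPart p ∩ newPart q ∣ ≤ (p ⊓ M) ∸ (q ∸ k)
  ∣newPart∩newPart∣ p q = ≤-trans (p⊆q⇒∣p∣≤∣q∣ ⊆interval) (≤-reflexive (∣interval∣ M (q ∸ k) p))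
    where
    ⊆interval : newPart p ∩ newPart q ⊆ interval M (q ∸ k) p
    ⊆interval r∈ with x∈p∩q⁻ (newPart p) (newPart q) r∈
    ... | r∈p , r∈q =
      ∈-interval⁺ M (q ∸ k) p (proj₁ (∈-interval⁻ M (q ∸ k) q r∈q)) (proj₂ (∈-interval⁻ M (p ∸ k) p r∈p))

  next-overlap<k : ∀ p → suc p ≤ M + k → ∣ window p ∩ window (suc p) ∣ + 1 ≤ k
  next-overlap<k p 1+p≤M+k with suc p ≤? M
  ... | yes 1+p≤M = ≤-trans (+-monoˡ-≤ 1 (∣window∩window∣-≤
                      (≤-trans (∣p∩q∣≤∣q∣ (oldPart p) (oldPart (suc p))) (≤-reflexive (∣oldPart∣-≤M 1+p≤M)))
                      (∣newPart∩newPart∣ p (suc p))))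
                      (next-overlap-size<k-low 1≤k 1+p≤M)
  ... | no 1+p≰M  = ≤-trans (+-monoˡ-≤ 1 (∣window∩window∣-≤
                      (≤-trans (∣p∩q∣≤∣p∣ (oldPart p) (oldPart (suc p))) (≤-reflexive (∣oldPart∣-≥k k≤p)))
                      (∣newPart∩newPart∣ p (suc p))))
                      (next-overlap-size<k-high k≤M (≰⇒> 1+p≰M) 1+p≤M+k)
    where
    k≤p : k ≤ p
    k≤p = ≤-trans k≤M (s≤s⁻¹ (≰⇒> 1+p≰M))

  next-overlap≥k∸1 : ∀ p → suc p ≤ M + k → k ∸ 1 ≤ ∣ window p ∩ window (suc p) ∣
  next-overlap≥k∸1 p 1+p≤M+k with suc p ≤? k
  ... | yes 1+p≤k = ≤-trans (next-overlap-size≥k∸1-low 1+p≤k k≤M)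
                      (≤-trans (≤-reflexive (sym sizes)) (∣window∩window∣-≥ T-part new-part))
    where
    sizes : ∣ dropMembers (suc p) T ∣ + ∣ newPart p ∣ ≡ (k ∸ suc p) + ((p ⊓ M) ∸ (p ∸ k))
    sizes = cong₂ _+_ (trans (∣dropMembers∣ (suc p) T) (cong (_∸ suc p) ∣T∣≡k)) (∣newPart∣ p)
    T-part : dropMembers (suc p) T ⊆ oldPart p ∩ oldPart (suc p)
    T-part a∈ = x∈p∩q⁺ (x∈p∪q⁺ (inj₁ (dropMembers-antimono (n≤1+n p) T a∈)) , x∈p∪q⁺ (inj₁ a∈))
    new-part : newPart p ⊆ newPart p ∩ newPart (suc p)
    new-part {q} q∈ = x∈p∩q⁺ (q∈ , ∈-interval⁺ M (suc p ∸ k) (suc p)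
                        (subst (_≤ toℕ q) (sym (m≤n⇒m∸n≡0 1+p≤k)) z≤n)
                        (≤-trans (proj₂ (∈-interval⁻ M (p ∸ k) p q∈)) (n≤1+n p)))
  ... | no 1+p≰k  = ≤-trans (next-overlap-size≥k∸1-high k≤M k≤p 1+p≤M+k)
                      (≤-trans (≤-reflexive (sym sizes)) (∣window∩window∣-≥ S-part new-part))
    where
    k≤p : k ≤ p
    k≤p = s≤s⁻¹ (≰⇒> 1+p≰k)
    sizes : ∣ takeMembers (p ∸ M) S ∣ + ∣ interval M (suc p ∸ k) p ∣ ≡ ((p ∸ M) ⊓ k) + ((p ⊓ M) ∸ (suc p ∸ k))
    sizes = cong₂ _+_ (trans (∣takeMembers∣ (p ∸ M) S) (cong ((p ∸ M) ⊓_) ∣S∣≡k)) (∣interval∣ M (suc p ∸ k) p)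
    S-part : takeMembers (p ∸ M) S ⊆ oldPart p ∩ oldPart (suc p)
    S-part a∈ = x∈p∩q⁺ (x∈p∪q⁺ (inj₂ a∈) , x∈p∪q⁺ (inj₂ (takeMembers-mono (∸-monoˡ-≤ M (n≤1+n p)) S a∈)))
    new-part : interval M (suc p ∸ k) p ⊆ newPart p ∩ newPart (suc p)
    new-part q∈ with ∈-interval⁻ M (suc p ∸ k) p q∈
    ... | lo≤q , q<p = x∈p∩q⁺ (∈-interval⁺ M (p ∸ k) p (≤-trans (∸-monoˡ-≤ k (n≤1+n p)) lo≤q) q<p ,
                               ∈-interval⁺ M (suc p ∸ k) (suc p) lo≤q (≤-trans q<p (n≤1+n p)))

  next-windows-adjacent : ∀ p → suc p ≤ M + k → ConfAdj joined k (window p) (window (suc p))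
  next-windows-adjacent p 1+p≤M+k = window-KIS (≤-trans (n≤1+n p) 1+p≤M+k) , window-KIS 1+p≤M+k ,
    ≤-antisym (m+n≤o⇒m≤o∸n _ (next-overlap<k p 1+p≤M+k)) (next-overlap≥k∸1 p 1+p≤M+k)

  windows-walk : Walk joined k (M + k) (T ++ ⊥) (S ++ ⊥)
  windows-walk = subst₂ (Walk joined k (M + k)) window-first window-last (walk-from 0 (M + k) (+-identityʳ (M + k)))
    where
    walk-from : ∀ p j → j + p ≡ M + k → Walk joined k j (window p) (window (M + k))
    walk-from p zero    refl = nil (window-KIS ≤-refl)
    walk-from p (suc j) j+p≡ = cons (next-windows-adjacent p (≤-trans (s≤s (m≤n+m p j)) (≤-reflexive j+p≡)))
                                    (walk-from (suc p) j (trans (+-suc j p) j+p≡))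

  distant-windows-overlap : ∀ p q → p + 2 ≤ q → q ≤ M + k →
    ∣ window p ∩ window q ∣ + 2 ≤ k ⊎ ∣ window p ∩ window q ∣ ≤ ∣ T ∩ S ∣
  distant-windows-overlap p q p+2≤q q≤M+k with q ≤? M
  ... | yes q≤M = inj₁ (≤-trans (+-monoˡ-≤ 2 (∣window∩window∣-≤
                    (≤-trans (∣p∩q∣≤∣q∣ (oldPart p) (oldPart q)) (≤-reflexive (∣oldPart∣-≤M q≤M)))
                    (∣newPart∩newPart∣ p q)))
                    (distant-overlap-size≤k∸2-low 2≤k p+2≤q q≤M))
  ... | no q≰M with k ≤? p
  ...   | yes k≤p = inj₁ (≤-trans (+-monoˡ-≤ 2 (∣window∩window∣-≤
                      (≤-trans (∣p∩q∣≤∣p∣ (oldPart p) (oldPart q)) (≤-reflexive (∣oldPart∣-≥k k≤p)))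
                      (∣newPart∩newPart∣ p q)))
                      (distant-overlap-size≤k∸2-high 2≤k k≤p p+2≤q q≤M+k))
  ...   | no k≰p  = inj₂ (≤-trans (∣window∩window∣-≤
                      (∣∩∣-mono (oldPart⊆T p≤M) (oldPart⊆S k≤q))
                      (≤-trans (∣newPart∩newPart∣ p q)
                               (≤-reflexive (distant-newParts-size≡0 (≰⇒> k≰p) (≰⇒> q≰M) k+k≤M+1))))
                      (≤-reflexive (+-identityʳ _)))
    where
    p≤M : p ≤ M
    p≤M = ≤-trans (<⇒≤ (≰⇒> k≰p)) k≤M
    k≤q : k ≤ q
    k≤q = ≤-trans k≤M (<⇒≤ (≰⇒> q≰M))

  lift : Subset x → Subset (x + M)
  lift o = o ++ ⊥

  ∣lift∣ : ∀ o → ∣ lift o ∣ ≡ ∣ o ∣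
  ∣lift∣ o = trans (∣p++q∣≡∣p∣+∣q∣ o ⊥) (trans (cong (∣ o ∣ +_) (∣⊥∣≡0 M)) (+-identityʳ _))

  ∣lift∩∣ : ∀ o o′ (g : Subset M) → ∣ lift o ∩ (o′ ++ g) ∣ ≡ ∣ o ∩ o′ ∣
  ∣lift∩∣ o o′ g =
    trans (cong ∣_∣ (trans (++-∩-++ o o′ ⊥ g) (cong ((o ∩ o′) ++_) (∩-zeroˡ g)))) (∣lift∣ (o ∩ o′))

  lift-KIS : ∀ {o} → IsKIS X k o → IsKIS joined k (lift o)
  lift-KIS {o} (o-ind , ∣o∣≡k) =
    parts⇒independent record
      { old-independent = o-ind
      ; old⊆slot        = λ _ q∈⊥ → contradiction q∈⊥ ∉⊥
      ; new-close       = λ q∈⊥ _ → contradiction q∈⊥ ∉⊥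
      } ,
    trans (∣lift∣ o) ∣o∣≡k

  unlift-KIS : ∀ {o} → IsKIS joined k (lift o) → IsKIS X k o
  unlift-KIS {o} (ind , ∣lift-o∣≡k) = old-independent (independent⇒parts ind) , trans (sym (∣lift∣ o)) ∣lift-o∣≡k

  lift-adj : ∀ {o o′} → ConfAdj X k o o′ → ConfAdj joined k (lift o) (lift o′)
  lift-adj {o} {o′} (o-KIS , o′-KIS , ∣o∩o′∣) = lift-KIS o-KIS , lift-KIS o′-KIS , trans (∣lift∩∣ o o′ ⊥) ∣o∩o′∣

  unlift-adj : ∀ {o o′} → ConfAdj joined k (lift o) (lift o′) → ConfAdj X k o o′
  unlift-adj {o} {o′} (o-KIS , o′-KIS , ∣∩∣) =
    unlift-KIS o-KIS , unlift-KIS o′-KIS , trans (sym (∣lift∩∣ o o′ ⊥)) ∣∩∣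

  lift-near-window : ∀ {o p} → 1 ≤ p → p < M + k → k ∸ 1 ≤ ∣ lift o ∩ window p ∣ →
    (p ≡ 1 × k ∸ 1 ≤ ∣ o ∩ T ∣) ⊎ (suc p ≡ M + k × k ∸ 1 ≤ ∣ o ∩ S ∣)
  lift-near-window {o} {p} 1≤p p<M+k ≤∣∩∣ with p ≤? M
  ... | yes p≤M = inj₁ (k∸1≤k∸p⇒p≡1 1≤p 2≤k
                         (≤-trans ≤∣o∩oldPart∣ (≤-trans (∣p∩q∣≤∣q∣ o (oldPart p)) (≤-reflexive (∣oldPart∣-≤M p≤M))))
                       , ≤-trans ≤∣o∩oldPart∣ (∣∩∣-monoʳ o (oldPart⊆T p≤M)))
    where
    ≤∣o∩oldPart∣ : k ∸ 1 ≤ ∣ o ∩ oldPart p ∣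
    ≤∣o∩oldPart∣ = ≤-trans ≤∣∩∣ (≤-reflexive (∣lift∩∣ o (oldPart p) (newPart p)))
  ... | no p≰M  = inj₂ (k∸1≤[p∸M]⊓k⇒1+p≡M+k (≰⇒> p≰M) p<M+k
                         (≤-trans ≤∣o∩oldPart∣ (≤-trans (∣p∩q∣≤∣q∣ o (oldPart p)) (≤-reflexive (∣oldPart∣-≥k k≤p))))
                       , ≤-trans ≤∣o∩oldPart∣ (∣∩∣-monoʳ o (oldPart⊆S k≤p)))
    where
    ≤∣o∩oldPart∣ : k ∸ 1 ≤ ∣ o ∩ oldPart p ∣
    ≤∣o∩oldPart∣ = ≤-trans ≤∣∩∣ (≤-reflexive (∣lift∩∣ o (oldPart p) (newPart p)))
    k≤p : k ≤ p
    k≤p = ≤-trans k≤M (<⇒≤ (≰⇒> p≰M))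

  Lifted : Subset (x + M) → Set
  Lifted Y = Σ (Subset x) λ o → Y ≡ lift o

  IsInteriorWindow : ℕ → Subset (x + M) → Set
  IsInteriorWindow p Y = 1 ≤ p × p < M + k × Y ≡ window p

  InteriorWindow : Subset (x + M) → Set
  InteriorWindow Y = Σ ℕ λ p → IsInteriorWindow p Y

  lift≢interior-window : ∀ {o p} → ¬ IsInteriorWindow p (lift o)
  lift≢interior-window {o} {p} (1≤p , p<M+k , lift-o≡window) =
    <⇒≢ (interior-newPart-nonempty 1≤k k≤M 1≤p p<M+k)
      (sym (trans (sym (∣newPart∣ p)) (trans (cong ∣_∣ (sym (++-injectiveʳ o (oldPart p) lift-o≡window))) (∣⊥∣≡0 M))))

  KIS-lift⊎interior-window : ∀ {Y} → IsKIS joined k Y → Lifted Y ⊎ InteriorWindow Y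
  KIS-lift⊎interior-window {Y} Y-KIS with Vec.splitAt x Y
  ... | o , g , Y≡o++g with nonempty? g
  ...   | no g-empty = inj₁ (o , trans Y≡o++g (cong (o ++_) (Empty-unique g-empty)))
  ...   | yes (_ , q∈g) with minimum-member g q∈g | maximum-member g q∈g
  ...     | q₀ , q₀∈g , q₀≤ | q₁ , q₁∈g , ≤q₁ = inj₂ (by-cases (suc (toℕ q₁) ≤? k))
    where
    P : IndependentParts o g
    P = independent⇒parts (subst (Independent joined k) Y≡o++g (proj₁ Y-KIS))
    o++g⊆window⇒Y≡window : ∀ p → p ≤ M + k → (o ++ g) ⊆ window p → Y ≡ window p
    o++g⊆window⇒Y≡window p p≤M+k ⊆window = trans Y≡o++g (p⊆q∧∣q∣≤∣p∣⇒p≡q ⊆window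
      (≤-reflexive (trans (∣window∣ p≤M+k) (sym (trans (cong ∣_∣ (sym Y≡o++g)) (proj₂ Y-KIS))))))
    by-cases : Dec (suc (toℕ q₁) ≤ k) → InteriorWindow Y
    by-cases (yes 1+q₁≤k) = suc (toℕ q₁) , s≤s z≤n , q₁+1<M+k ,
                              o++g⊆window⇒Y≡window (suc (toℕ q₁)) (<⇒≤ q₁+1<M+k) (++-mono-⊆ o⊆ g⊆)
      where
      q₁+1<M+k : suc (toℕ q₁) < M + k
      q₁+1<M+k = ≤-trans (s≤s (toℕ<n q₁)) (≤-trans (≤-reflexive (+-comm 1 M)) (+-monoʳ-≤ M 1≤k))
      o⊆ : o ⊆ oldPart (suc (toℕ q₁))
      o⊆ a∈ with x∈p∪q⁻ (dropMembers (suc (toℕ q₁)) T) (takeMembers (toℕ q₁ + k ∸ M) S) (old⊆slot P a∈ q₁∈g)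
      ... | inj₁ a∈T = x∈p∪q⁺ (inj₁ a∈T)
      ... | inj₂ a∈S = contradiction (≤-reflexive (1+q≤k⇒q+k∸M≡0 1+q₁≤k k+k≤M+1))
                         (<⇒≱ (∈takeMembers⇒0<j (toℕ q₁ + k ∸ M) S a∈S))
      g⊆ : g ⊆ newPart (suc (toℕ q₁))
      g⊆ {r} r∈g = ∈-interval⁺ M (suc (toℕ q₁) ∸ k) (suc (toℕ q₁))
                      (subst (_≤ toℕ r) (sym (m≤n⇒m∸n≡0 1+q₁≤k)) z≤n) (s≤s (≤q₁ r∈g))
    by-cases (no 1+q₁≰k)  = toℕ q₀ + k , ≤-trans 1≤k (m≤n+m k (toℕ q₀)) , q₀+k<M+k ,
                              o++g⊆window⇒Y≡window (toℕ q₀ + k) (<⇒≤ q₀+k<M+k) (++-mono-⊆ o⊆ g⊆)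
      where
      k≤q₁ : k ≤ toℕ q₁
      k≤q₁ = s≤s⁻¹ (≰⇒> 1+q₁≰k)
      q₀+k<M+k : toℕ q₀ + k < M + k
      q₀+k<M+k = +-monoˡ-< k (toℕ<n q₀)
      g⊆ : g ⊆ newPart (toℕ q₀ + k)
      g⊆ {r} r∈g = ∈-interval⁺ M (toℕ q₀ + k ∸ k) (toℕ q₀ + k)
                      (subst (_≤ toℕ r) (sym (m+n∸n≡m (toℕ q₀) k)) (q₀≤ r∈g))
                      (≤-trans (far≡false⇒< (toℕ q₀) (toℕ r) (new-close P q₀∈g r∈g)) (≤-reflexive (+-comm k (toℕ q₀))))
      o⊆ : o ⊆ oldPart (toℕ q₀ + k)
      o⊆ a∈ with x∈p∪q⁻ (dropMembers (suc (toℕ q₁)) T) (takeMembers (toℕ q₁ + k ∸ M) S) (old⊆slot P a∈ q₁∈g)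
      ... | inj₁ a∈T = contradiction (≤-trans k≤q₁ (n≤1+n _))
                         (<⇒≱ (subst (suc (toℕ q₁) <_) ∣T∣≡k (∈dropMembers⇒j<∣v∣ (suc (toℕ q₁)) T a∈T)))
      ... | inj₂ a∈S₁
        with x∈p∪q⁻ (dropMembers (suc (toℕ q₀)) T) (takeMembers (toℕ q₀ + k ∸ M) S) (old⊆slot P a∈ q₀∈g)
      ...   | inj₂ a∈S₀ = x∈p∪q⁺ (inj₂ a∈S₀)
      ...   | inj₁ a∈T  = contradiction
                            (≤-reflexive (m≤n⇒m∸n≡0 (slot-of-max-new-vertex-avoids-S
                              (subst (suc (toℕ q₀) <_) ∣T∣≡k (∈dropMembers⇒j<∣v∣ (suc (toℕ q₀)) T a∈T))
                              (far≡false⇒< (toℕ q₀) (toℕ q₁) (new-close P q₀∈g q₁∈g)) 3k≤M+2)))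
                            (<⇒≱ (∈takeMembers⇒0<j (toℕ q₁ + k ∸ M) S a∈S₁))

-- Chaining the components

offsets : ∀ {s} → ℕ → (Fin (suc s) → ℕ) → Fin (suc s) → ℕ
offsets         L d zero    = 0
offsets {suc s} L d (suc t) = d zero + L + offsets L (d ∘ suc) t

offsets-suc : ∀ {s} L (d : Fin (suc s) → ℕ) (t : Fin s) →
  offsets L d (suc t) ≡ L + (offsets L d (inject₁ t) + d (inject₁ t))
offsets-suc {suc s} L d zero    = solve 2 (λ a l → a :+ l :+ con 0 := l :+ (con 0 :+ a)) refl (d zero) L
  where open +-*-Solver
offsets-suc {suc s} L d (suc t) rewrite offsets-suc L (d ∘ suc) t =
  solve 4 (λ a l o e → a :+ l :+ (l :+ (o :+ e)) := l :+ (a :+ l :+ o :+ e)) refl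
    (d zero) L (offsets L (d ∘ suc) (inject₁ t)) (d (suc (inject₁ t)))
  where open +-*-Solver

offsets-last : ∀ {s} L (d : Fin (suc s) → ℕ) → offsets L d (fromℕ s) + d (fromℕ s) ≡ L * s + sumFin d
offsets-last {zero}  L d = solve 2 (λ l a → con 0 :+ a := l :* con 0 :+ (a :+ con 0)) refl L (d zero)
  where open +-*-Solver
offsets-last {suc s} L d = begin
  d zero + L + offsets L (d ∘ suc) (fromℕ s) + d (suc (fromℕ s))
    ≡⟨ +-assoc (d zero + L) _ _ ⟩
  d zero + L + (offsets L (d ∘ suc) (fromℕ s) + d (suc (fromℕ s)))
    ≡⟨ cong (d zero + L +_) (offsets-last L (d ∘ suc)) ⟩
  d zero + L + (L * s + sumFin (d ∘ suc))
    ≡⟨ solve 4 (λ a l s r → a :+ l :+ (l :* s :+ r) := l :* (con 1 :+ s) :+ (a :+ r)) refl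
         (d zero) L s (sumFin (d ∘ suc)) ⟩
  L * suc s + sumFin d ∎
  where
  open ≡-Reasoning
  open +-*-Solver

module Chain (k : ℕ) (3≤k : 3 ≤ k) (n : ℕ) (G : Graph n) (s : ℕ) (d : Fin (suc s) → ℕ)
             (C : Components G k (suc s) d) where

  open Components C

  M : ℕ
  M = 3 * k ∸ 2

  L : ℕ
  L = 4 * k ∸ 4

  S : Fin (suc s) → Subset n
  S c = proj₁ (diamAttained c)

  T : Fin (suc s) → Subset n
  T c = proj₁ (proj₂ (diamAttained c))

  S-KIS : ∀ c → IsKIS G k (S c)
  S-KIS c = proj₁ (proj₂ (proj₂ (diamAttained c)))

  T-KIS : ∀ c → IsKIS G k (T c)
  T-KIS c = proj₁ (proj₂ (proj₂ (proj₂ (diamAttained c))))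

  comp-S : ∀ c → comp (S c) (S-KIS c) ≡ c
  comp-S c = proj₁ (proj₂ (proj₂ (proj₂ (proj₂ (diamAttained c)))))

  comp-T : ∀ c → comp (T c) (T-KIS c) ≡ c
  comp-T c = proj₁ (proj₂ (proj₂ (proj₂ (proj₂ (proj₂ (diamAttained c))))))

  S⇝T : ∀ c → Dist G k (S c) (T c) (d c)
  S⇝T c = proj₂ (proj₂ (proj₂ (proj₂ (proj₂ (proj₂ (diamAttained c))))))

  walk⇒same-comp : ∀ {ℓ X Y} → Walk G k ℓ X Y → (X-KIS : IsKIS G k X) (Y-KIS : IsKIS G k Y) →
                   comp X X-KIS ≡ comp Y Y-KIS
  walk⇒same-comp w X-KIS Y-KIS = Equivalence.from (sameComp _ _ X-KIS Y-KIS) (_ , w)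

  -- offset c bounds from below the number of steps from S zero to component c in the final graph.
  offset : Fin (suc s) → ℕ
  offset = offsets L d

  ReachableIn : Fin (suc s) → Subset n → ℕ → Set
  ReachableIn c X a = Σ ℕ λ b → Walk G k b (S c) X × offset c + b ≤ a

  Reachable : (X : Subset n) → IsKIS G k X → ℕ → Set
  Reachable X X-KIS a = ReachableIn (comp X X-KIS) X a

  reachable-mono : ∀ {X c a a′} → a ≤ a′ → ReachableIn c X a → ReachableIn c X a′
  reachable-mono a≤a′ (b , w , ≤a) = b , w , ≤-trans ≤a a≤a′

  reachable-walk : ∀ {X Y c a b′} → ReachableIn c X a → Walk G k b′ X Y → ReachableIn c Y (a + b′)
  reachable-walk {c = c} {b′ = b′} (b , w , ≤a) w′ =
    b + b′ , walk-++ w w′ , ≤-trans (≤-reflexive (sym (+-assoc (offset c) b b′))) (+-monoˡ-≤ b′ ≤a)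

  reachable-step : ∀ {X Y c a b′} → b′ ≤ 1 → ReachableIn c X a → Walk G k b′ X Y → ReachableIn c Y (suc a)
  reachable-step {a = a} b′≤1 r w =
    reachable-mono (≤-trans (+-monoʳ-≤ a b′≤1) (≤-reflexive (+-comm a 1))) (reachable-walk r w)

  reachable-transport : ∀ {X c c′ a} → c ≡ c′ → ReachableIn c X a → ReachableIn c′ X a
  reachable-transport refl r = r

  reachable-T⇒ : ∀ {c a} → ReachableIn c (T c) a → offset c + d c ≤ a
  reachable-T⇒ {c} (b , w , ≤a) = ≤-trans (+-monoʳ-≤ (offset c) (≮⇒≥ λ b<d → proj₂ (S⇝T c) b b<d w)) ≤a

  -- Layer c is the graph obtained by joining components 0, …, c.  Inv Y a over-approximates
  -- “some walk from S zero reaches Y in a steps”, and is exact enough on embedded sets (inv-end).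
  record Layer (c : Fin (suc s)) : Set₁ where
    field
      size                : ℕ
      size≤               : size ≤ n + M * toℕ c
      graph               : Graph size
      embed               : Subset n → Subset size
      embed-KIS           : ∀ {o} → IsKIS G k o → IsKIS graph k (embed o)
      embed-adj           : ∀ {o o′} → ConfAdj G k o o′ → ConfAdj graph k (embed o) (embed o′)
      ∣embed∩embed∣       : ∀ o o′ → ∣ embed o ∩ embed o′ ∣ ≡ ∣ o ∩ o′ ∣
      Inv                 : Subset size → ℕ → Set
      inv-start           : Inv (embed (S zero)) 0
      inv-step            : ∀ {Y Y′ a} → Inv Y a → ConfAdj graph k Y Y′ → Inv Y′ (suc a)
      inv-end             : ∀ {X a} (X-KIS : IsKIS G k X) → Inv (embed X) a → Reachable X X-KIS a
      inv-near⇒reachable  : ∀ {Y X a} → IsKIS graph k Y → Inv Y a → (X-KIS : IsKIS G k X) →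
                            k ∸ 1 ≤ ∣ Y ∩ embed X ∣ → Reachable X X-KIS (suc a)
      reachable-near⇒inv  : ∀ {Y X a} → IsKIS graph k Y → (X-KIS : IsKIS G k X) →
                            k ∸ 1 ≤ ∣ Y ∩ embed X ∣ → Reachable X X-KIS a → Inv Y (suc a)
      S₀⇝T                : Σ ℕ λ ℓ → Walk graph k ℓ (embed (S zero)) (embed (T c))

    inv-walk : ∀ {ℓ Y Y′ a} → Inv Y a → Walk graph k ℓ Y Y′ → Inv Y′ (a + ℓ)
    inv-walk {a = a} inv (nil _)           = subst (Inv _) (sym (+-identityʳ a)) inv
    inv-walk {suc ℓ} {a = a} inv (cons YY′ w) = subst (Inv _) (sym (+-suc a ℓ)) (inv-walk (inv-step inv YY′) w)

  first-layer : Layer zero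
  first-layer = record
    { size               = n
    ; size≤              = m≤m+n n _
    ; graph              = G
    ; embed              = λ o → o
    ; embed-KIS          = λ o-KIS → o-KIS
    ; embed-adj          = λ oo′ → oo′
    ; ∣embed∩embed∣      = λ _ _ → refl
    ; Inv                = Inv
    ; inv-start          = S-KIS zero , reachable-transport (sym (comp-S zero)) (0 , nil (S-KIS zero) , ≤-refl)
    ; inv-step           = inv-step
    ; inv-end            = inv-end
    ; inv-near⇒reachable = inv-near⇒reachable
    ; reachable-near⇒inv = reachable-near⇒inv
    ; S₀⇝T               = d zero , proj₁ (S⇝T zero)
    }
    where
    Inv : Subset n → ℕ → Set
    Inv Y a = Σ (IsKIS G k Y) λ Y-KIS → Reachable Y Y-KIS a

    reachable-short-walk : ∀ {X Y a} → (Σ ℕ λ b → b ≤ 1 × Walk G k b X Y) →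
                           (X-KIS : IsKIS G k X) (Y-KIS : IsKIS G k Y) → Reachable X X-KIS a → Reachable Y Y-KIS (suc a)
    reachable-short-walk (b , b≤1 , w) X-KIS Y-KIS r =
      reachable-transport (walk⇒same-comp w X-KIS Y-KIS) (reachable-step b≤1 r w)

    inv-step : ∀ {Y Y′ a} → Inv Y a → ConfAdj G k Y Y′ → Inv Y′ (suc a)
    inv-step (Y-KIS , r) YY′@(_ , Y′-KIS , _) =
      Y′-KIS , reachable-short-walk (1 , ≤-refl , cons YY′ (nil Y′-KIS)) Y-KIS Y′-KIS r

    inv-end : ∀ {X a} (X-KIS : IsKIS G k X) → Inv X a → Reachable X X-KIS a
    inv-end X-KIS (X-KIS′ , r) = reachable-transport (walk⇒same-comp (nil X-KIS′) X-KIS′ X-KIS) r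

    inv-near⇒reachable : ∀ {Y X a} → IsKIS G k Y → Inv Y a → (X-KIS : IsKIS G k X) →
                         k ∸ 1 ≤ ∣ Y ∩ X ∣ → Reachable X X-KIS (suc a)
    inv-near⇒reachable _ (Y-KIS , r) X-KIS ≤∣Y∩X∣ =
      reachable-short-walk (overlap⇒walk≤1 Y-KIS X-KIS ≤∣Y∩X∣) Y-KIS X-KIS r

    reachable-near⇒inv : ∀ {Y X a} → IsKIS G k Y → (X-KIS : IsKIS G k X) →
                         k ∸ 1 ≤ ∣ Y ∩ X ∣ → Reachable X X-KIS a → Inv Y (suc a)
    reachable-near⇒inv {Y} {X} Y-KIS X-KIS ≤∣Y∩X∣ r =
      Y-KIS , reachable-short-walk (overlap⇒walk≤1 X-KIS Y-KIS (≤-trans ≤∣Y∩X∣ (≤-reflexive (∣p∩q∣≡∣q∩p∣ Y X))))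
                                   X-KIS Y-KIS r

  module Join (t : Fin s) (layer : Layer (inject₁ t)) where

    module Prev = Layer layer

    this next : Fin (suc s)
    this = inject₁ t
    next = suc t

    open Gadget Prev.graph k M (Prev.embed (T this)) (Prev.embed (S next)) (≤-trans (n≤1+n 2) 3≤k)
                (k+k+k≤[3k∸2]+2 3≤k) (Prev.embed-KIS (T-KIS this)) (Prev.embed-KIS (S-KIS next))

    arrival : ℕ
    arrival = offset this + d this

    offset-next : offset next ≡ L + arrival
    offset-next = offsets-suc L d t

    last-window : ∀ {p} → suc p ≡ M + k → p ≡ suc L
    last-window 1+p≡M+k = suc-injective (trans 1+p≡M+k (sym (2+[4k∸4]≡[3k∸2]+k 3≤k)))

    k∸1+2≰k : ¬ (k ∸ 1 + 2 ≤ k)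
    k∸1+2≰k le = 1+n≰n (≤-trans (≤-reflexive (sym (trans (+-comm (k ∸ 1) 2) (cong suc (m+[n∸m]≡n 1≤k))))) le)

    T-far-from-S : ¬ (k ∸ 1 ≤ ∣ Prev.embed (T this) ∩ Prev.embed (S next) ∣)
    T-far-from-S ≤∣∩∣ with overlap⇒walk≤1 (T-KIS this) (S-KIS next)
                             (≤-trans ≤∣∩∣ (≤-reflexive (Prev.∣embed∩embed∣ (T this) (S next))))
    ... | _ , _ , w = <-irrefl (trans (sym (toℕ-inject₁ t)) (cong toℕ this≡next)) (n<1+n (toℕ t))
      where
      this≡next : this ≡ next
      this≡next = trans (sym (comp-T this)) (trans (walk⇒same-comp w (T-KIS this) (S-KIS next)) (comp-S next))

    comp-near-T : ∀ {X b} (X-KIS : IsKIS G k X) → Walk G k b X (T this) → comp X X-KIS ≡ this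
    comp-near-T X-KIS w = trans (walk⇒same-comp w X-KIS (T-KIS this)) (comp-T this)

    comp-near-S : ∀ {X b} (X-KIS : IsKIS G k X) → Walk G k b (S next) X → comp X X-KIS ≡ next
    comp-near-S X-KIS w = trans (sym (walk⇒same-comp w (S-KIS next) X-KIS)) (comp-S next)

    reachable-next⇒ : ∀ {X a} → ReachableIn next X a → L + arrival ≤ a
    reachable-next⇒ (b , _ , ≤a) = ≤-trans (≤-reflexive (sym offset-next)) (≤-trans (m≤m+n (offset next) b) ≤a)

    reach-T : ∀ {a} → arrival ≤ a → Reachable (T this) (T-KIS this) a
    reach-T ≤a = reachable-transport (sym (comp-T this)) (d this , proj₁ (S⇝T this) , ≤a)

    reach-S : ∀ {a} → L + arrival ≤ a → Reachable (S next) (S-KIS next) a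
    reach-S ≤a = reachable-transport (sym (comp-S next))
                   (0 , nil (S-KIS next) , ≤-trans (≤-reflexive (trans (+-identityʳ _) offset-next)) ≤a)

    embed⁺ : Subset n → Subset (Prev.size + M)
    embed⁺ o = lift (Prev.embed o)

    -- Window 1 can be entered from a neighbour of T this, hence one step of slack.
    Inv⁺ : Subset (Prev.size + M) → ℕ → Set
    Inv⁺ Y a = (Σ (Subset Prev.size) λ o → Y ≡ lift o × Prev.Inv o a) ⊎
               (Σ ℕ λ p → IsInteriorWindow p Y × p + arrival ≤ suc a)

    near-window⇒near-T⊎near-S : ∀ {X p} (X-KIS : IsKIS G k X) → 1 ≤ p → p < M + k →
      k ∸ 1 ≤ ∣ window p ∩ embed⁺ X ∣ →
      (p ≡ 1 × Σ ℕ λ b → b ≤ 1 × Walk G k b X (T this)) ⊎ (p ≡ suc L × Σ ℕ λ b → b ≤ 1 × Walk G k b (S next) X)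
    near-window⇒near-T⊎near-S {X} {p} X-KIS 1≤p p<M+k ≤∣∩∣
      with lift-near-window {Prev.embed X} 1≤p p<M+k (≤-trans ≤∣∩∣ (≤-reflexive (∣p∩q∣≡∣q∩p∣ (window p) (embed⁺ X))))
    ... | inj₁ (p≡1 , near-T) = inj₁ (p≡1 , overlap⇒walk≤1 X-KIS (T-KIS this)
                                  (≤-trans near-T (≤-reflexive (Prev.∣embed∩embed∣ X (T this)))))
    ... | inj₂ (1+p≡M+k , near-S) = inj₂ (last-window 1+p≡M+k , overlap⇒walk≤1 (S-KIS next) X-KIS
                                  (≤-trans near-S (≤-reflexive (trans (Prev.∣embed∩embed∣ X (S next))
                                                                      (∣p∩q∣≡∣q∩p∣ X (S next))))))

    inv⁺-step : ∀ {Y Y′ a} → Inv⁺ Y a → ConfAdj joined k Y Y′ → Inv⁺ Y′ (suc a)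
    inv⁺-step inv YY′@(_ , Y′-KIS , _) = by-cases inv (KIS-lift⊎interior-window Y′-KIS) YY′
      where
      by-cases : ∀ {Y Y′ a} → Inv⁺ Y a → Lifted Y′ ⊎ InteriorWindow Y′ → ConfAdj joined k Y Y′ → Inv⁺ Y′ (suc a)
      by-cases (inj₁ (o , refl , inv)) (inj₁ (o′ , refl)) oo′ = inj₁ (o′ , refl , Prev.inv-step inv (unlift-adj oo′))
      by-cases (inj₁ (o , refl , inv)) (inj₂ (q , 1≤q , q<M+k , refl)) (o-KIS , _ , ∣∩∣)
        with lift-near-window {o} 1≤q q<M+k (≤-reflexive (sym ∣∩∣))
      ... | inj₁ (refl , near-T) = inj₂ (1 , (1≤q , q<M+k , refl) , s≤s (reachable-T⇒ (reachable-transport (comp-T this)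
              (Prev.inv-near⇒reachable (unlift-KIS o-KIS) inv (T-KIS this) near-T))))
      ... | inj₂ (1+q≡M+k , near-S) with refl ← last-window 1+q≡M+k =
              inj₂ (suc L , (1≤q , q<M+k , refl) , s≤s (reachable-next⇒ (reachable-transport (comp-S next)
                (Prev.inv-near⇒reachable (unlift-KIS o-KIS) inv (S-KIS next) near-S))))
      by-cases (inj₂ (p , (1≤p , p<M+k , refl) , bound)) (inj₁ (o′ , refl)) (_ , o′-KIS , ∣∩∣)
        with lift-near-window {o′} 1≤p p<M+k (≤-reflexive (sym (trans (∣p∩q∣≡∣q∩p∣ (lift o′) (window p)) ∣∩∣)))
      ... | inj₁ (refl , near-T) =
              inj₁ (o′ , refl , Prev.reachable-near⇒inv (unlift-KIS o′-KIS) (T-KIS this) near-T (reach-T (s≤s⁻¹ bound)))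
      ... | inj₂ (1+p≡M+k , near-S) with refl ← last-window 1+p≡M+k =
              inj₁ (o′ , refl , Prev.reachable-near⇒inv (unlift-KIS o′-KIS) (S-KIS next) near-S (reach-S (s≤s⁻¹ bound)))
      by-cases (inj₂ (p , (_ , _ , refl) , bound)) (inj₂ (q , 1≤q , q<M+k , refl)) (_ , _ , ∣∩∣) with q ≤? suc p
      ... | yes q≤1+p = inj₂ (q , (1≤q , q<M+k , refl) , ≤-trans (+-monoˡ-≤ arrival q≤1+p) (s≤s bound))
      ... | no q≰1+p with distant-windows-overlap p q (≤-trans (≤-reflexive (+-comm p 2)) (≰⇒> q≰1+p)) (<⇒≤ q<M+k)
      ...   | inj₁ ∣∩∣+2≤k  = contradiction (subst (λ c → c + 2 ≤ k) ∣∩∣ ∣∩∣+2≤k) k∸1+2≰k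
      ...   | inj₂ ∣∩∣≤∣T∩S∣ = contradiction (≤-trans (≤-reflexive (sym ∣∩∣)) ∣∩∣≤∣T∩S∣) T-far-from-S

    inv⁺-end : ∀ {X a} (X-KIS : IsKIS G k X) → Inv⁺ (embed⁺ X) a → Reachable X X-KIS a
    inv⁺-end {X} {a} X-KIS (inj₁ (o , eq , inv)) =
      Prev.inv-end X-KIS (subst (λ o → Prev.Inv o a) (sym (++-injectiveˡ (Prev.embed X) o eq)) inv)
    inv⁺-end X-KIS (inj₂ (p , p-interior , _)) = contradiction p-interior lift≢interior-window

    inv⁺-near⇒reachable : ∀ {Y X a} → IsKIS joined k Y → Inv⁺ Y a → (X-KIS : IsKIS G k X) →
                          k ∸ 1 ≤ ∣ Y ∩ embed⁺ X ∣ → Reachable X X-KIS (suc a)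
    inv⁺-near⇒reachable {X = X} Y-KIS (inj₁ (o , refl , inv)) X-KIS ≤∣∩∣ =
      Prev.inv-near⇒reachable (unlift-KIS Y-KIS) inv X-KIS (≤-trans ≤∣∩∣ (≤-reflexive (∣lift∩∣ o (Prev.embed X) ⊥)))
    inv⁺-near⇒reachable {X = X} {a} _ (inj₂ (p , (1≤p , p<M+k , refl) , bound)) X-KIS ≤∣∩∣
      with near-window⇒near-T⊎near-S X-KIS 1≤p p<M+k ≤∣∩∣
    ... | inj₁ (refl , _ , _ , w) with diamBound this (S this) X (S-KIS this) X-KIS (comp-S this) (comp-near-T X-KIS w)
    ...   | b , b≤d , S⇝X = reachable-transport (sym (comp-near-T X-KIS w))
              (b , S⇝X , ≤-trans (+-monoʳ-≤ (offset this) b≤d) (≤-trans (s≤s⁻¹ bound) (n≤1+n a)))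
    inv⁺-near⇒reachable {X = X} {a} _ (inj₂ (p , (1≤p , p<M+k , refl) , bound)) X-KIS ≤∣∩∣
      | inj₂ (refl , b , b≤1 , w) = reachable-transport (sym (comp-near-S X-KIS w))
              (b , w , ≤-trans (+-mono-≤ (≤-reflexive offset-next) b≤1)
                               (≤-trans (+-monoˡ-≤ 1 (s≤s⁻¹ bound)) (≤-reflexive (+-comm a 1))))

    reachable-near⇒inv⁺ : ∀ {Y X a} → IsKIS joined k Y → (X-KIS : IsKIS G k X) →
                          k ∸ 1 ≤ ∣ Y ∩ embed⁺ X ∣ → Reachable X X-KIS a → Inv⁺ Y (suc a)
    reachable-near⇒inv⁺ {Y} {X} {a} Y-KIS X-KIS ≤∣∩∣ r with KIS-lift⊎interior-window Y-KIS
    ... | inj₁ (o , refl) = inj₁ (o , refl , Prev.reachable-near⇒inv (unlift-KIS Y-KIS) X-KIS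
                              (≤-trans ≤∣∩∣ (≤-reflexive (∣lift∩∣ o (Prev.embed X) ⊥))) r)
    ... | inj₂ (p , 1≤p , p<M+k , refl)
      with near-window⇒near-T⊎near-S X-KIS 1≤p p<M+k ≤∣∩∣
    ...   | inj₁ (refl , _ , b≤1 , w) = inj₂ (1 , (1≤p , p<M+k , refl) ,
              s≤s (reachable-T⇒ (reachable-step b≤1 (reachable-transport (comp-near-T X-KIS w) r) w)))
    ...   | inj₂ (refl , _ , _ , w) = inj₂ (suc L , (1≤p , p<M+k , refl) ,
              s≤s (≤-trans (reachable-next⇒ (reachable-transport (comp-near-S X-KIS w) r)) (n≤1+n a)))

    S₀⇝T⁺ : Σ ℕ λ ℓ → Walk joined k ℓ (embed⁺ (S zero)) (embed⁺ (T next))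
    S₀⇝T⁺ = proj₁ Prev.S₀⇝T + (M + k + d next) ,
      walk-++ (walk-map lift lift-KIS lift-adj (proj₂ Prev.S₀⇝T))
        (walk-++ windows-walk
          (walk-map embed⁺ (λ o-KIS → lift-KIS (Prev.embed-KIS o-KIS)) (λ oo′ → lift-adj (Prev.embed-adj oo′))
                    (proj₁ (S⇝T next))))

    size⁺≤ : Prev.size + M ≤ n + M * toℕ next
    size⁺≤ = begin
      Prev.size + M          ≤⟨ +-monoˡ-≤ M Prev.size≤ ⟩
      n + M * toℕ this + M   ≡⟨ cong (λ i → n + M * i + M) (toℕ-inject₁ t) ⟩
      n + M * toℕ t + M      ≡⟨ +-assoc n (M * toℕ t) M ⟩
      n + (M * toℕ t + M)    ≡⟨ cong (n +_) (trans (+-comm (M * toℕ t) M) (sym (*-suc M (toℕ t)))) ⟩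
      n + M * suc (toℕ t)    ∎
      where open ≤-Reasoning

    next-layer : Layer next
    next-layer = record
      { size               = Prev.size + M
      ; size≤              = size⁺≤
      ; graph              = joined
      ; embed              = embed⁺
      ; embed-KIS          = λ o-KIS → lift-KIS (Prev.embed-KIS o-KIS)
      ; embed-adj          = λ oo′ → lift-adj (Prev.embed-adj oo′)
      ; ∣embed∩embed∣      = λ o o′ → trans (∣lift∩∣ (Prev.embed o) (Prev.embed o′) ⊥) (Prev.∣embed∩embed∣ o o′)
      ; Inv                = Inv⁺
      ; inv-start          = inj₁ (Prev.embed (S zero) , refl , Prev.inv-start)
      ; inv-step           = inv⁺-step
      ; inv-end            = inv⁺-end
      ; inv-near⇒reachable = inv⁺-near⇒reachable
      ; reachable-near⇒inv = reachable-near⇒inv⁺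
      ; S₀⇝T               = S₀⇝T⁺
      }

  layer : ∀ c → Layer c
  layer = <-weakInduction Layer first-layer Join.next-layer

  module Last = Layer (layer (fromℕ s))

  long-diameter : Σ ℕ λ m → m ≤ n + (3 * k ∸ 2) * s × Σ (Graph m) λ H →
                  DiameterAtLeast H k ((4 * k ∸ 4) * s + sumFin d)
  long-diameter = Last.size , subst (λ i → Last.size ≤ n + M * i) (toℕ-fromℕ s) Last.size≤ , Last.graph ,
                  Last.embed (S zero) , Last.embed (T (fromℕ s)) , Last.S₀⇝T , no-shorter-walk
    where
    no-shorter-walk : ∀ ℓ → ℓ < L * s + sumFin d → ¬ Walk Last.graph k ℓ (Last.embed (S zero)) (Last.embed (T (fromℕ s)))
    no-shorter-walk ℓ ℓ< w = <⇒≱ ℓ< (begin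
      L * s + sumFin d                ≡⟨ sym (offsets-last L d) ⟩
      offset (fromℕ s) + d (fromℕ s)  ≤⟨ reachable-T⇒ (reachable-transport (comp-T (fromℕ s))
                                           (Last.inv-end (T-KIS (fromℕ s)) (Last.inv-walk Last.inv-start w))) ⟩
      ℓ                               ∎)
      where open ≤-Reasoning

mainTheorem6 : (k : ℕ) → 3 ≤ k → (n : ℕ) → (G : Graph n) →
    (r : ℕ) → 1 ≤ r → (d : Fin r → ℕ) → Components G k r d →
    Σ ℕ λ m → m ≤ n + (3 * k ∸ 2) * (r ∸ 1) × Σ (Graph m) λ H →
      DiameterAtLeast H k ((4 * k ∸ 4) * (r ∸ 1) + sumFin d)
mainTheorem6 k 3≤k n G zero    ()  d C
mainTheorem6 k 3≤k n G (suc s) 1≤r d C = Chain.long-diameter k 3≤k n G s d C
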